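{- Let $M$ be a nonuniform matroid on a set $S$. Then $M$ is irreducible with respect to free product if and only if the lattice $\mathcal{D}(M)$ contains no nontrivial pinchpoint.
   Context: For a matroid $M$ on $S$, write $\rho(M)$ for its rank, $\nu_M(A)=|A|-\rho_M(A)$ and $\lambda_M(A)=\rho(M)-\rho_M(A)$. For matroids $M$ on $S$ and $N$ on $T$ with $S\cap T=\emptyset$, the free product $M\mathbin{\Box} N$ is the matroid on $S\cup T$ whose independent sets are the $A\subseteq S\cup T$ with $A\cap S$ independent in $M$ and $\lambda_M(A\cap S)\geq\nu_N(A\cap T)$. A nonempty matroid is irreducible if every factorization of it as a free product of matroids contains it as a factor. A cyclic flat of $M$ is a flat that is a union of circuits. $\mathcal{D}(M)$ is the complete sublattice of the Boolean algebra $2^S$ generated by the cyclic flats of $M$ (closed under arbitrary unions and intersections; in particular it contains the empty union $\emptyset$ and the empty intersection $S$). An element $x$ of a poset $P$ is a pinchpoint if every element of $P$ is comparable to $x$; it is nontrivial if it is neither minimal nor maximal in $P$. -}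

module Defs where

open import Data.Nat using (ℕ; zero; suc; _+_; _∸_; _≤_; _<_; _⊔_; _≤?_)
open import Data.Bool using (true; false)
open import Data.Fin using (Fin)
open import Data.Fin.Subset using (Subset; _∈_; _∉_; _⊆_; _⊂_; _∪_; ⁅_⁆; ∣_∣; ⊥; ⊤)
open import Data.Fin.Subset.Properties using (_⊆?_)
open import Data.Vec using (Vec; []; _∷_; take; drop; tabulate; lookup)
open import Data.List using (List; []; _∷_; [_]; map; _++_; filter; foldr)
open import Data.List.Relation.Unary.Any using (Any)
open import Data.Product using (Σ; ∃; _×_; _,_; proj₁; proj₂)
open import Relation.Nullary using (¬_; Dec)
open import Relation.Nullary.Decidable using (_×-dec_)
open import Relation.Unary using (Pred; Decidable)
open import Relation.Binary.PropositionalEquality using (_≡_)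
open import Data.Sum using (_⊎_)
open import Function.Bundles using (_⇔_; _↔_; Inverse)

record SetSystem (n : ℕ) : Set₁ where
  field
    Indep  : Subset n → Set
    indep? : Decidable Indep

allSubsets : (n : ℕ) → List (Subset n)
allSubsets zero    = [ [] ]
allSubsets (suc n) = map (true ∷_) (allSubsets n) ++ map (false ∷_) (allSubsets n)

maxList : List ℕ → ℕ
maxList = foldr _⊔_ 0

module _ {n : ℕ} (M : SetSystem n) where
  open SetSystem M

  rk : Subset n → ℕ
  rk A = maxList (map ∣_∣ (filter (λ B → (B ⊆? A) ×-dec indep? B) (allSubsets n)))

  rank : ℕ
  rank = rk ⊤

  nullity : Subset n → ℕ
  nullity A = ∣ A ∣ ∸ rk A

  corank : Subset n → ℕ
  corank A = rank ∸ rk A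

record Matroid (n : ℕ) : Set₁ where
  field
    sys : SetSystem n
  open SetSystem sys public
  field
    indep-∅     : Indep ⊥
    indep-down  : ∀ {A B} → Indep A → B ⊆ A → Indep B
    indep-aug   : ∀ {A B} → Indep A → Indep B → ∣ A ∣ < ∣ B ∣ →
                  ∃ λ x → x ∈ B × x ∉ A × Indep (⁅ x ⁆ ∪ A)

-- Free product.  Ground set of M □ N is Fin (m + n): the first m
-- elements are S (ground set of M), the last n are T (ground set of N).

_□_ : {m n : ℕ} → SetSystem m → SetSystem n → SetSystem (m + n)
_□_ {m} {n} M N = record
  { Indep  = λ A → SetSystem.Indep M (take m A) × nullity N (drop m A) ≤ corank M (take m A)
  ; indep? = λ A → SetSystem.indep? M (take m A) ×-dec (nullity N (drop m A) ≤? corank M (take m A))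
  }

emptySys : SetSystem 0
emptySys = record { Indep = λ _ → Data.Unit.⊤ ; indep? = λ _ → Relation.Nullary.yes Data.Unit.tt }
  where import Data.Unit; import Relation.Nullary

prodList : List (Σ ℕ Matroid) → Σ ℕ SetSystem
prodList []             = 0 , emptySys
prodList ((k , M) ∷ fs) = (k + proj₁ (prodList fs)) , (Matroid.sys M □ proj₂ (prodList fs))

pullback : {m n : ℕ} → (Fin m → Fin n) → Subset n → Subset m
pullback f B = tabulate (λ i → lookup B (f i))

_≅_ : {m n : ℕ} → SetSystem m → SetSystem n → Set
_≅_ {m} {n} M N = Σ (Fin m ↔ Fin n) λ f →
  ∀ (B : Subset n) → SetSystem.Indep N B ⇔ SetSystem.Indep M (pullback (Inverse.to f) B)

Irreducible : {n : ℕ} → Matroid n → Set₁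
Irreducible {n} M =
  0 < n ×
  (∀ (fs : List (Σ ℕ Matroid)) → Matroid.sys M ≅ proj₂ (prodList fs) →
     Any (λ kN → Matroid.sys (proj₂ kN) ≅ Matroid.sys M) fs)

Uniform : {n : ℕ} → Matroid n → Set
Uniform {n} M = ∃ λ (r : ℕ) → ∀ (A : Subset n) → Matroid.Indep M A ⇔ ∣ A ∣ ≤ r

NonUniform : {n : ℕ} → Matroid n → Set
NonUniform M = ¬ Uniform M

module _ {n : ℕ} (M : Matroid n) where
  open Matroid M

  Circuit : Subset n → Set
  Circuit C = ¬ Indep C × (∀ D → D ⊂ C → Indep D)

  Flat : Subset n → Set
  Flat F = ∀ x → rk sys (⁅ x ⁆ ∪ F) ≡ rk sys F → x ∈ F

  UnionOfCircuits : Subset n → Set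
  UnionOfCircuits F = ∀ x → x ∈ F → ∃ λ C → Circuit C × x ∈ C × C ⊆ F

  CyclicFlat : Subset n → Set
  CyclicFlat F = Flat F × UnionOfCircuits F

  -- 𝒟(M): the complete sublattice of 2^S generated by the cyclic flats,
  -- i.e. the smallest family containing the cyclic flats and closed under
  -- unions and intersections of arbitrary (possibly empty) subfamilies.
  data InD : Subset n → Set₁ where
    cyc  : ∀ {F} → CyclicFlat F → InD F
    join : (P : Subset n → Set) → (∀ B → P B → InD B) →
           ∀ A → (∀ x → x ∈ A ⇔ (∃ λ B → P B × x ∈ B)) → InD A
    meet : (P : Subset n → Set) → (∀ B → P B → InD B) →
           ∀ A → (∀ x → x ∈ A ⇔ (∀ B → P B → x ∈ B)) → InD A

  Pinchpoint : Subset n → Set₁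
  Pinchpoint X = InD X × (∀ Y → InD Y → Y ⊆ X ⊎ X ⊆ Y)

  MinimalInD : Subset n → Set₁
  MinimalInD X = InD X × (∀ Y → InD Y → Y ⊆ X → Y ≡ X)

  MaximalInD : Subset n → Set₁
  MaximalInD X = InD X × (∀ Y → InD Y → X ⊆ Y → Y ≡ X)

  NontrivialPinchpoint : Subset n → Set₁
  NontrivialPinchpoint X = Pinchpoint X × ¬ MinimalInD X × ¬ MaximalInD X

  NoNontrivialPinchpoint : Set₁
  NoNontrivialPinchpoint = ¬ (∃ λ X → NontrivialPinchpoint X)

-- A free factorisation M ≅ P □ Q splits the ground set into the parts S and T of P and Q, and
-- every cyclic flat Z is comparable with S: if Z contains t ∈ T but misses s ∈ S, take a basis B
-- of Z avoiding t (t lies on a circuit inside Z); B + s is independent because Z is a flat, and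
-- the rank bound defining P □ Q then makes B + t independent as well, which is absurd.
-- Conversely, if every cyclic flat is comparable with a proper nonempty X, then M ≅ M|X □ M/X:
-- for A with A ∩ X independent the free-product bound says exactly ∣A∣ ≤ r(A ∪ X), and this
-- fails for dependent A, because the closure of a circuit of A is a cyclic flat that either
-- lies in X or spans X.
-- Finally, if X is comparable with every cyclic flat, each member of 𝒟(M) lies below
-- ⋃{Z ⊆ X} or above X, and below X or above ⋂{Z ⊇ X}; so these two sets are pinchpoints, and
-- both are trivial only when every cyclic flat is ∅ or S, that is, when M is uniform.

module Submission where

open import Defs
open import Data.Bool using (true; false; if_then_else_)
open import Data.Empty using (⊥-elim)
open import Data.Fin using (Fin; zero; suc; _↑ˡ_; _↑ʳ_; splitAt; cast)
open import Data.Fin.Permutation using (↔⇒≡)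
open import Data.Fin.Properties
  using (any?; ↑ˡ-injective; ↑ʳ-injective; splitAt⁻¹-↑ˡ; splitAt⁻¹-↑ʳ; toℕ-injective; toℕ-cast; toℕ-↑ˡ;
         splitAt-join; join-splitAt; splitAt-↑ˡ; splitAt-↑ʳ)
open import Data.Fin.Subset using (Subset; _∈_; _∉_; _⊆_; _⊂_; _∪_; ⁅_⁆; ∣_∣; ⊥; ⊤; ∁; _-_)
open import Data.Fin.Subset.Properties
  using (_∈?_; _⊆?_; ⊆-refl; ⊆-reflexive; ⊆-trans; ⊆-antisym; ⊥⊆; ⊆⊤; ∈⊤; ∉⊥; ∣⊥∣≡0; Empty-unique;
         nonempty?; x∈⁅x⁆; x∈⁅y⁆⇒x≡y; ∣⁅x⁆∣≡1; p⊆p∪q; q⊆p∪q; x∈p∪q⁻; x∈p∪q⁺; ∪-identityˡ;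
         p⊆q⇒∣p∣≤∣q∣; p⊂q⇒∣p∣<∣q∣; x∉p⇒x∈∁p; p─q⊆p; x∈p⇒p-x⊂p; x∈p⇒∣p-x∣<∣p∣; x∈p∧x≢y⇒x∈p-y)
open import Data.List using (List; []; _∷_; map; filter)
open import Data.List.Membership.Propositional using () renaming (_∈_ to _∈ₗ_)
open import Data.List.Membership.Propositional.Properties
  using (∈-map⁺; ∈-map⁻; ∈-filter⁺; ∈-filter⁻; ∈-++⁺ˡ; ∈-++⁺ʳ)
open import Data.List.Relation.Unary.Any using (Any; here; there)
open import Data.Nat using (ℕ; zero; suc; _+_; _∸_; _≤_; _<_; _≟_; _<?_; z≤n; s≤s)
open import Data.Nat.Properties
open import Algebra.Properties.CommutativeMonoid.Sum +-0-commutativeMonoid using (sum; sum-permute; sum-cong-≗)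
open import Data.Product using (Σ; ∃; ∃-syntax; _×_; _,_; proj₁; proj₂)
open import Data.Sum as Sum using (_⊎_; inj₁; inj₂; [_,_]′)
open import Data.Sum.Function.Propositional using (_⊎-↔_)
open import Data.Vec using (Vec; []; _∷_; lookup; tabulate; take; drop; _++_)
open import Data.Vec.Properties
  using (take++drop≡id; lookup∘tabulate; tabulate-cong; []=⇒lookup; lookup⇒[]=; lookup-++ˡ; lookup-++ʳ)
open import Function using (id; _∘_; _∘′_; flip; case_of_)
open import Function.Bundles using (_⇔_; mk⇔; Equivalence; _↔_; Inverse; mk↔ₛ′)
open import Function.Construct.Composition using (_↔-∘_)
open import Function.Construct.Symmetry using (↔-sym; ⇔-sym)
open import Function.Properties.Equivalence using () renaming (trans to ⇔-trans)
open import Function.Properties.Inverse using (↔-refl)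
open import Relation.Binary.PropositionalEquality
open import Relation.Nullary using (¬_; Dec; yes; no; does; ¬?; _×-dec_)
open import Relation.Nullary.Decidable using (decidable-stable; dec-true; dec-false; ¬¬-excluded-middle)

private
  variable
    n m k : ℕ

suc-∸-≤ : ∀ a b → suc a ∸ b ≤ suc (a ∸ b)
suc-∸-≤ a b = m≤n+o⇒m∸n≤o (suc a) b (≤-trans (s≤s (m≤n+m∸n a b)) (≤-reflexive (sym (+-suc b (a ∸ b)))))

+≤+⇔∸≤∸ : ∀ {l q s x} → l ≤ x → (l + q ≤ s + x ⇔ q ∸ s ≤ x ∸ l)
+≤+⇔∸≤∸ {l} {q} {s} {x} l≤x = mk⇔ to from
  where
  open ≤-Reasoning
  to : l + q ≤ s + x → q ∸ s ≤ x ∸ l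
  to l+q≤s+x = m≤n+o⇒m∸n≤o q s (begin
    q              ≤⟨ m+n≤o⇒m≤o∸n q (subst (_≤ s + x) (+-comm l q) l+q≤s+x) ⟩
    s + x ∸ l      ≡⟨ +-∸-assoc s l≤x ⟩
    s + (x ∸ l)    ∎)
  from : q ∸ s ≤ x ∸ l → l + q ≤ s + x
  from q∸s≤x∸l = begin
    l + q                ≤⟨ +-monoʳ-≤ l (m≤n+m∸n q s) ⟩
    l + (s + (q ∸ s))    ≡⟨ trans (+-comm l _) (+-assoc s (q ∸ s) l) ⟩
    s + ((q ∸ s) + l)    ≤⟨ +-monoʳ-≤ s (m≤o∸n⇒m+n≤o (q ∸ s) l≤x q∸s≤x∸l) ⟩
    s + x                ∎

m≢m+n : ∀ m {n} → 0 < n → m ≢ m + n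
m≢m+n m {suc n} _ eq = m≢1+m+n m (trans eq (+-suc m n))

∪-lub : {p q r : Subset n} → p ⊆ r → q ⊆ r → p ∪ q ⊆ r
∪-lub {p = p} {q} p⊆r q⊆r x∈ = [ p⊆r , q⊆r ]′ (x∈p∪q⁻ p q x∈)

∪-monoʳ : {p q r : Subset n} → q ⊆ r → p ∪ q ⊆ p ∪ r
∪-monoʳ {p = p} {r = r} q⊆r = ∪-lub (p⊆p∪q r) (⊆-trans q⊆r (q⊆p∪q p r))

⊆-or-witness : (p q : Subset n) → p ⊆ q ⊎ ∃[ x ] (x ∈ p × x ∉ q)
⊆-or-witness p q with any? (λ x → x ∈? p ×-dec ¬? (x ∈? q))
... | yes witness = inj₂ witness
... | no none     = inj₁ λ {x} x∈p → decidable-stable (x ∈? q) (λ x∉q → none (x , x∈p , x∉q))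

module _ {x : Fin n} {p : Subset n} where

  x∈⁅x⁆∪p : x ∈ ⁅ x ⁆ ∪ p
  x∈⁅x⁆∪p = x∈p∪q⁺ (inj₁ (x∈⁅x⁆ x))

  p⊆⁅x⁆∪p : p ⊆ ⁅ x ⁆ ∪ p
  p⊆⁅x⁆∪p = q⊆p∪q ⁅ x ⁆ p

  ∈⁅x⁆∪p⁻ : ∀ {y} → y ∈ ⁅ x ⁆ ∪ p → y ≡ x ⊎ y ∈ p
  ∈⁅x⁆∪p⁻ y∈ = Sum.map₁ (x∈⁅y⁆⇒x≡y x) (x∈p∪q⁻ ⁅ x ⁆ p y∈)

  ⁅x⁆∪p⊆q : ∀ {q} → x ∈ q → p ⊆ q → ⁅ x ⁆ ∪ p ⊆ q
  ⁅x⁆∪p⊆q x∈q = ∪-lub (λ y∈ → subst (_∈ _) (sym (x∈⁅y⁆⇒x≡y x y∈)) x∈q)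

∣⁅x⁆∪p∣≡1+∣p∣ : (x : Fin n) (p : Subset n) → x ∉ p → ∣ ⁅ x ⁆ ∪ p ∣ ≡ suc ∣ p ∣
∣⁅x⁆∪p∣≡1+∣p∣ zero    (false ∷ p) _   = cong suc (cong ∣_∣ (∪-identityˡ p))
∣⁅x⁆∪p∣≡1+∣p∣ zero    (true  ∷ p) x∉p = ⊥-elim (x∉p Data.Vec.here)
∣⁅x⁆∪p∣≡1+∣p∣ (suc x) (true  ∷ p) x∉p = cong suc (∣⁅x⁆∪p∣≡1+∣p∣ x p (λ x∈p → x∉p (Data.Vec.there x∈p)))
∣⁅x⁆∪p∣≡1+∣p∣ (suc x) (false ∷ p) x∉p = ∣⁅x⁆∪p∣≡1+∣p∣ x p (λ x∈p → x∉p (Data.Vec.there x∈p))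

∣⁅x⁆∪p∣≤1+∣p∣ : (x : Fin n) (p : Subset n) → ∣ ⁅ x ⁆ ∪ p ∣ ≤ suc ∣ p ∣
∣⁅x⁆∪p∣≤1+∣p∣ x p with x ∈? p
... | yes x∈p = m≤n⇒m≤1+n (p⊆q⇒∣p∣≤∣q∣ (⁅x⁆∪p⊆q x∈p ⊆-refl))
... | no  x∉p = ≤-reflexive (∣⁅x⁆∪p∣≡1+∣p∣ x p x∉p)

p⊆q⇒∣q∣≤∣p∣⇒q⊆p : {p q : Subset n} → p ⊆ q → ∣ q ∣ ≤ ∣ p ∣ → q ⊆ p
p⊆q⇒∣q∣≤∣p∣⇒q⊆p {p = p} p⊆q ∣q∣≤∣p∣ {x} x∈q =
  decidable-stable (x ∈? p) (λ x∉p → <⇒≱ (p⊂q⇒∣p∣<∣q∣ (p⊆q , x , x∈q , x∉p)) ∣q∣≤∣p∣)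

x∈p⇒0<∣p∣ : {x : Fin n} {p : Subset n} → x ∈ p → 0 < ∣ p ∣
x∈p⇒0<∣p∣ {x = x} {p} x∈p =
  ≤-trans (≤-reflexive (sym (∣⁅x⁆∣≡1 x))) (p⊆q⇒∣p∣≤∣q∣ (λ y∈ → subst (_∈ p) (sym (x∈⁅y⁆⇒x≡y x y∈)) x∈p))

∈-tabulate-does : {P : Fin n → Set} (P? : ∀ x → Dec (P x)) {x : Fin n} → x ∈ tabulate (does ∘ P?) ⇔ P x
∈-tabulate-does P? {x} = mk⇔
  (λ x∈ → decidable-stable (P? x) λ ¬Px → case trans (sym (dec-false (P? x) ¬Px)) (does≡true x∈) of λ ())
  (λ Px → lookup⇒[]= x _ (trans (lookup∘tabulate _ x) (dec-true (P? x) Px)))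
  where
  does≡true : x ∈ tabulate (does ∘ P?) → does (P? x) ≡ true
  does≡true x∈ = trans (sym (lookup∘tabulate _ x)) ([]=⇒lookup x∈)

¬¬-decidable : (P : Fin n → Set) → ¬ ¬ (∀ x → Dec (P x))
¬¬-decidable {zero}  P no-decider = no-decider λ ()
¬¬-decidable {suc n} P no-decider = ¬¬-decidable (P ∘ suc) λ decide-suc →
  ¬¬-excluded-middle λ decide-zero → no-decider λ { zero → decide-zero ; (suc x) → decide-suc x }

∈-by-lookup : {p : Subset m} {q : Subset n} {x : Fin m} {y : Fin n} →
              lookup p x ≡ lookup q y → x ∈ p → y ∈ q
∈-by-lookup {q = q} {y = y} eq x∈p = lookup⇒[]= y q (trans (sym eq) ([]=⇒lookup x∈p))

module _ (φ : Fin m → Fin n) {B : Subset n} {x : Fin m} where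

  ∈-pullback⁺ : φ x ∈ B → x ∈ pullback φ B
  ∈-pullback⁺ = ∈-by-lookup (sym (lookup∘tabulate _ x))

  ∈-pullback⁻ : x ∈ pullback φ B → φ x ∈ B
  ∈-pullback⁻ = ∈-by-lookup (lookup∘tabulate _ x)

pullback-mono : (φ : Fin m → Fin n) {B B' : Subset n} → B ⊆ B' → pullback φ B ⊆ pullback φ B'
pullback-mono φ B⊆B' x∈ = ∈-pullback⁺ φ (B⊆B' (∈-pullback⁻ φ x∈))

lookup-take : ∀ {A : Set} m (V : Vec A (m + k)) (i : Fin m) → lookup (take m V) i ≡ lookup V (i ↑ˡ k)
lookup-take (suc m) (x ∷ V) zero    = refl
lookup-take (suc m) (x ∷ V) (suc i) = lookup-take m V i

lookup-drop : ∀ {A : Set} m (V : Vec A (m + k)) (j : Fin k) → lookup (drop m V) j ≡ lookup V (m ↑ʳ j)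
lookup-drop zero    V       j = refl
lookup-drop (suc m) (x ∷ V) j = lookup-drop m V j

module _ {V : Subset (m + k)} where

  ∈-take⁺ : ∀ {i} → i ↑ˡ k ∈ V → i ∈ take m V
  ∈-take⁺ = ∈-by-lookup (sym (lookup-take m V _))

  ∈-take⁻ : ∀ {i} → i ∈ take m V → i ↑ˡ k ∈ V
  ∈-take⁻ = ∈-by-lookup (lookup-take m V _)

  ∈-drop⁺ : ∀ {j} → m ↑ʳ j ∈ V → j ∈ drop m V
  ∈-drop⁺ = ∈-by-lookup (sym (lookup-drop m V _))

  ∈-drop⁻ : ∀ {j} → j ∈ drop m V → m ↑ʳ j ∈ V
  ∈-drop⁻ = ∈-by-lookup (lookup-drop m V _)

module _ {C : Subset m} {D : Subset k} where

  ∈-++ˡ⁺ : ∀ {i} → i ∈ C → i ↑ˡ k ∈ C ++ D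
  ∈-++ˡ⁺ = ∈-by-lookup (sym (lookup-++ˡ C D _))

  ∈-++ˡ⁻ : ∀ {i} → i ↑ˡ k ∈ C ++ D → i ∈ C
  ∈-++ˡ⁻ = ∈-by-lookup (lookup-++ˡ C D _)

  ∈-++ʳ⁺ : ∀ {j} → j ∈ D → m ↑ʳ j ∈ C ++ D
  ∈-++ʳ⁺ = ∈-by-lookup (sym (lookup-++ʳ C D _))

  ∈-++ʳ⁻ : ∀ {j} → m ↑ʳ j ∈ C ++ D → j ∈ D
  ∈-++ʳ⁻ = ∈-by-lookup (lookup-++ʳ C D _)

∣p++q∣≡∣p∣+∣q∣ : (p : Subset m) (q : Subset k) → ∣ p ++ q ∣ ≡ ∣ p ∣ + ∣ q ∣
∣p++q∣≡∣p∣+∣q∣ []          q = refl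
∣p++q∣≡∣p∣+∣q∣ (true  ∷ p) q = cong suc (∣p++q∣≡∣p∣+∣q∣ p q)
∣p++q∣≡∣p∣+∣q∣ (false ∷ p) q = ∣p++q∣≡∣p∣+∣q∣ p q

private
  indicator : Subset n → Fin n → ℕ
  indicator p i = if lookup p i then 1 else 0

  ∣p∣≡sum-indicator : (p : Subset n) → ∣ p ∣ ≡ sum (indicator p)
  ∣p∣≡sum-indicator []          = refl
  ∣p∣≡sum-indicator (true  ∷ p) = cong suc (∣p∣≡sum-indicator p)
  ∣p∣≡sum-indicator (false ∷ p) = ∣p∣≡sum-indicator p

module _ (π : Fin m ↔ Fin n) where
  open Inverse π

  ∣pullback-from∣ : (A : Subset m) → ∣ pullback from A ∣ ≡ ∣ A ∣
  ∣pullback-from∣ A = begin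
    ∣ pullback from A ∣                 ≡⟨ ∣p∣≡sum-indicator (pullback from A) ⟩
    sum (indicator (pullback from A))   ≡⟨ sum-cong-≗ (cong (if_then 1 else 0) ∘ lookup∘tabulate (lookup A ∘ from)) ⟩
    sum (λ y → indicator A (from y))    ≡⟨ sum-permute (indicator A) (↔-sym π) ⟨
    sum (indicator A)                   ≡⟨ ∣p∣≡sum-indicator A ⟨
    ∣ A ∣                               ∎
    where open ≡-Reasoning

  pullback-to-from : (A : Subset m) → pullback to (pullback from A) ≡ A
  pullback-to-from A = ⊆-antisym
    (λ x∈ → subst (_∈ A) (strictlyInverseʳ _) (∈-pullback⁻ from (∈-pullback⁻ to x∈)))
    (λ {x} x∈ → ∈-pullback⁺ to (∈-pullback⁺ from (subst (_∈ A) (sym (strictlyInverseʳ x)) x∈)))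

  pullback-from-⁅⁆∪ : (x : Fin m) (A : Subset m) → pullback from (⁅ x ⁆ ∪ A) ≡ ⁅ to x ⁆ ∪ pullback from A
  pullback-from-⁅⁆∪ x A = ⊆-antisym ⊆-split (⁅x⁆∪p⊆q to-x∈ (pullback-mono from (p⊆⁅x⁆∪p {x = x})))
    where
    to-x∈ : to x ∈ pullback from (⁅ x ⁆ ∪ A)
    to-x∈ = ∈-pullback⁺ from (subst (_∈ ⁅ x ⁆ ∪ A) (sym (strictlyInverseʳ x)) x∈⁅x⁆∪p)
    ⊆-split : pullback from (⁅ x ⁆ ∪ A) ⊆ ⁅ to x ⁆ ∪ pullback from A
    ⊆-split {y} y∈ with ∈⁅x⁆∪p⁻ (∈-pullback⁻ from y∈)
    ... | inj₁ from-y≡x = subst (_∈ _) (trans (cong to (sym from-y≡x)) (strictlyInverseˡ y)) x∈⁅x⁆∪p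
    ... | inj₂ from-y∈A = p⊆⁅x⁆∪p (∈-pullback⁺ from from-y∈A)

take≡pullback-↑ˡ : (V : Subset (m + k)) → take m V ≡ pullback (_↑ˡ k) V
take≡pullback-↑ˡ V = ⊆-antisym (λ i∈ → ∈-pullback⁺ _ (∈-take⁻ i∈)) (λ i∈ → ∈-take⁺ (∈-pullback⁻ _ i∈))

↑ˡ0-↔ : Fin m ↔ Fin (m + 0)
↑ˡ0-↔ {m} = mk↔ₛ′ (_↑ˡ 0) (cast (+-identityʳ m))
  (λ y → toℕ-injective (trans (toℕ-↑ˡ _ 0) (toℕ-cast _ y)))
  (λ x → toℕ-injective (trans (toℕ-cast _ (x ↑ˡ 0)) (toℕ-↑ˡ x 0)))

+↔⊎ : Fin (m + k) ↔ (Fin m ⊎ Fin k)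
+↔⊎ {m} {k} = mk↔ₛ′ (splitAt m) (Data.Fin.join m k) (splitAt-join m k) (join-splitAt m k)

module Partition where

  to : (X : Subset n) → Fin n → Fin ∣ X ∣ ⊎ Fin ∣ ∁ X ∣
  to (true  ∷ X) zero    = inj₁ zero
  to (false ∷ X) zero    = inj₂ zero
  to (true  ∷ X) (suc x) = Sum.map₁ suc (to X x)
  to (false ∷ X) (suc x) = Sum.map₂ suc (to X x)

  from : (X : Subset n) → Fin ∣ X ∣ ⊎ Fin ∣ ∁ X ∣ → Fin n
  from []          (inj₁ ())
  from []          (inj₂ ())
  from (true  ∷ X) (inj₁ zero)    = zero
  from (true  ∷ X) (inj₁ (suc i)) = suc (from X (inj₁ i))
  from (true  ∷ X) (inj₂ j)       = suc (from X (inj₂ j))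
  from (false ∷ X) (inj₁ i)       = suc (from X (inj₁ i))
  from (false ∷ X) (inj₂ zero)    = zero
  from (false ∷ X) (inj₂ (suc j)) = suc (from X (inj₂ j))

  from-to : (X : Subset n) → ∀ x → from X (to X x) ≡ x
  from-to (true  ∷ X) zero    = refl
  from-to (false ∷ X) zero    = refl
  from-to (true  ∷ X) (suc x) with to X x | from-to X x
  ... | inj₁ i | eq = cong suc eq
  ... | inj₂ j | eq = cong suc eq
  from-to (false ∷ X) (suc x) with to X x | from-to X x
  ... | inj₁ i | eq = cong suc eq
  ... | inj₂ j | eq = cong suc eq

  to-from : (X : Subset n) → ∀ y → to X (from X y) ≡ y
  to-from []          (inj₁ ())
  to-from []          (inj₂ ())
  to-from (true  ∷ X) (inj₁ zero)    = refl
  to-from (true  ∷ X) (inj₁ (suc i)) = cong (Sum.map₁ suc) (to-from X (inj₁ i))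
  to-from (true  ∷ X) (inj₂ j)       = cong (Sum.map₁ suc) (to-from X (inj₂ j))
  to-from (false ∷ X) (inj₁ i)       = cong (Sum.map₂ suc) (to-from X (inj₁ i))
  to-from (false ∷ X) (inj₂ zero)    = refl
  to-from (false ∷ X) (inj₂ (suc j)) = cong (Sum.map₂ suc) (to-from X (inj₂ j))

  from-inj₁∈ : (X : Subset n) → ∀ i → from X (inj₁ i) ∈ X
  from-inj₁∈ (true  ∷ X) zero    = Data.Vec.here
  from-inj₁∈ (true  ∷ X) (suc i) = Data.Vec.there (from-inj₁∈ X i)
  from-inj₁∈ (false ∷ X) i       = Data.Vec.there (from-inj₁∈ X i)

  from-inj₂∉ : (X : Subset n) → ∀ j → from X (inj₂ j) ∉ X
  from-inj₂∉ (true  ∷ X) j       (Data.Vec.there ∈X) = from-inj₂∉ X j ∈X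
  from-inj₂∉ (false ∷ X) (suc j) (Data.Vec.there ∈X) = from-inj₂∉ X j ∈X

partition : (X : Subset n) → Fin n ↔ (Fin ∣ X ∣ ⊎ Fin ∣ ∁ X ∣)
partition X = mk↔ₛ′ (Partition.to X) (Partition.from X) (Partition.to-from X) (Partition.from-to X)

allSubsets-complete : (A : Subset n) → A ∈ₗ allSubsets n
allSubsets-complete []                = here refl
allSubsets-complete {suc n} (true  ∷ A) = ∈-++⁺ˡ (∈-map⁺ (true ∷_) (allSubsets-complete A))
allSubsets-complete {suc n} (false ∷ A) =
  ∈-++⁺ʳ (map (true ∷_) (allSubsets n)) (∈-map⁺ (false ∷_) (allSubsets-complete A))

maxList-ub : ∀ {x xs} → x ∈ₗ xs → x ≤ maxList xs
maxList-ub {xs = y ∷ xs} (here refl) = m≤m⊔n y (maxList xs)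
maxList-ub {xs = y ∷ xs} (there x∈)  = ≤-trans (maxList-ub x∈) (m≤n⊔m y (maxList xs))

maxList-lub : ∀ {c} xs → (∀ {x} → x ∈ₗ xs → x ≤ c) → maxList xs ≤ c
maxList-lub []       _  = z≤n
maxList-lub (y ∷ xs) ub = ⊔-lub (ub (here refl)) (maxList-lub xs (ub ∘′ there))

maxList-attained : ∀ xs → maxList xs ≡ 0 ⊎ maxList xs ∈ₗ xs
maxList-attained []       = inj₁ refl
maxList-attained (y ∷ xs) with ⊔-sel y (maxList xs) | maxList-attained xs
... | inj₁ max≡y | _           = inj₂ (here max≡y)
... | inj₂ max≡m | inj₁ m≡0    = inj₁ (trans max≡m m≡0)
... | inj₂ max≡m | inj₂ m∈xs   = inj₂ (subst (_∈ₗ y ∷ xs) (sym max≡m) (there m∈xs))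

module _ (S : SetSystem n) where
  open SetSystem S

  private
    candidates : Subset n → List (Subset n)
    candidates A = filter (λ I → (I ⊆? A) ×-dec indep? I) (allSubsets n)

  rk-ub : ∀ {A I} → Indep I → I ⊆ A → ∣ I ∣ ≤ rk S A
  rk-ub {A} {I} indep I⊆A =
    maxList-ub (∈-map⁺ ∣_∣ (∈-filter⁺ (λ I → (I ⊆? A) ×-dec indep? I) (allSubsets-complete I) (I⊆A , indep)))

  rk-lub : ∀ {A c} → (∀ I → I ⊆ A → Indep I → ∣ I ∣ ≤ c) → rk S A ≤ c
  rk-lub {A} ub = maxList-lub _ λ x∈ → case-candidate (∈-map⁻ ∣_∣ x∈)
    where
    case-candidate : ∀ {x} → ∃[ I ] (I ∈ₗ candidates A × x ≡ ∣ I ∣) → x ≤ _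
    case-candidate (I , I∈ , refl) with ∈-filter⁻ (λ I → (I ⊆? A) ×-dec indep? I) {xs = allSubsets n} I∈
    ... | _ , I⊆A , indep = ub I I⊆A indep

  rk-attained : Indep ⊥ → ∀ A → ∃[ I ] (I ⊆ A × Indep I × ∣ I ∣ ≡ rk S A)
  rk-attained indep-⊥ A with maxList-attained (map ∣_∣ (candidates A))
  ... | inj₁ rk≡0 = ⊥ , ⊥⊆ , indep-⊥ , trans (∣⊥∣≡0 n) (sym rk≡0)
  ... | inj₂ rk∈ with ∈-map⁻ ∣_∣ rk∈
  ...   | I , I∈ , rk≡∣I∣ with ∈-filter⁻ (λ I → (I ⊆? A) ×-dec indep? I) {xs = allSubsets n} I∈
  ...     | _ , I⊆A , indep = I , I⊆A , indep , sym rk≡∣I∣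

  rk-mono : ∀ {A A'} → A ⊆ A' → rk S A ≤ rk S A'
  rk-mono A⊆A' = rk-lub λ I I⊆A indep → rk-ub indep (⊆-trans I⊆A A⊆A')

  rk≤∣A∣ : ∀ A → rk S A ≤ ∣ A ∣
  rk≤∣A∣ A = rk-lub λ I I⊆A _ → p⊆q⇒∣p∣≤∣q∣ I⊆A

  indep⇒rk≡∣A∣ : ∀ {A} → Indep A → rk S A ≡ ∣ A ∣
  indep⇒rk≡∣A∣ {A} indep = ≤-antisym (rk≤∣A∣ A) (rk-ub indep ⊆-refl)

  indep⇒nullity≡0 : ∀ {A} → Indep A → nullity S A ≡ 0
  indep⇒nullity≡0 {A} indep = trans (cong (∣ A ∣ ∸_) (indep⇒rk≡∣A∣ indep)) (n∸n≡0 ∣ A ∣)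

  nullity≡0⇒indep : Indep ⊥ → ∀ {A} → nullity S A ≡ 0 → Indep A
  nullity≡0⇒indep indep-⊥ {A} nullity≡0 with rk-attained indep-⊥ A
  ... | I , I⊆A , indep , ∣I∣≡rk = subst Indep (⊆-antisym I⊆A A⊆I) indep
    where
    A⊆I : A ⊆ I
    A⊆I = p⊆q⇒∣q∣≤∣p∣⇒q⊆p I⊆A (subst (∣ A ∣ ≤_) (sym ∣I∣≡rk) (m∸n≡0⇒m≤n nullity≡0))

  nullity-⁅⁆∪ : ∀ x A → nullity S (⁅ x ⁆ ∪ A) ≤ suc (nullity S A)
  nullity-⁅⁆∪ x A = begin
    ∣ ⁅ x ⁆ ∪ A ∣ ∸ rk S (⁅ x ⁆ ∪ A) ≤⟨ ∸-monoʳ-≤ _ (rk-mono p⊆⁅x⁆∪p) ⟩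
    ∣ ⁅ x ⁆ ∪ A ∣ ∸ rk S A           ≤⟨ ∸-monoˡ-≤ (rk S A) (∣⁅x⁆∪p∣≤1+∣p∣ x A) ⟩
    suc ∣ A ∣ ∸ rk S A               ≤⟨ suc-∸-≤ ∣ A ∣ (rk S A) ⟩
    suc (nullity S A)                ∎
    where open ≤-Reasoning

rk-≤-indep : (S T : SetSystem n) → (∀ A → SetSystem.Indep S A → SetSystem.Indep T A) →
             ∀ A → rk S A ≤ rk T A
rk-≤-indep S T S⇒T A = rk-lub S λ I I⊆A indep → rk-ub T (S⇒T I indep) I⊆A

rk-cong : (S T : SetSystem n) → (∀ A → SetSystem.Indep S A ⇔ SetSystem.Indep T A) → ∀ A → rk S A ≡ rk T A
rk-cong S T S⇔T A =
  ≤-antisym (rk-≤-indep S T (Equivalence.to ∘ S⇔T) A) (rk-≤-indep T S (Equivalence.from ∘ S⇔T) A)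

module _ (P : SetSystem m) (Q : SetSystem k) where

  -- As ⁅ i ⁆ ∪ L is independent, adding i raises the rank in P; that frees a unit of nullity in Q.
  □-trade : ∀ {L R i j} → SetSystem.Indep P (⁅ i ⁆ ∪ L) → i ∉ L →
            nullity Q R ≤ corank P (⁅ i ⁆ ∪ L) → nullity Q (⁅ j ⁆ ∪ R) ≤ corank P L
  □-trade {L} {R} {i} {j} indep i∉L bound = begin
    nullity Q (⁅ j ⁆ ∪ R)            ≤⟨ nullity-⁅⁆∪ Q j R ⟩
    suc (nullity Q R)                ≤⟨ s≤s bound ⟩
    suc (rank P ∸ rk P (⁅ i ⁆ ∪ L))  ≤⟨ ∸-monoʳ-< rk-grows (rk-mono P ⊆⊤) ⟩
    rank P ∸ rk P L                  ∎
    where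
    open ≤-Reasoning
    rk-grows : rk P L < rk P (⁅ i ⁆ ∪ L)
    rk-grows = begin-strict
      rk P L                ≤⟨ rk≤∣A∣ P L ⟩
      ∣ L ∣                 <⟨ n<1+n ∣ L ∣ ⟩
      suc ∣ L ∣             ≡⟨ ∣⁅x⁆∪p∣≡1+∣p∣ i L i∉L ⟨
      ∣ ⁅ i ⁆ ∪ L ∣         ≡⟨ indep⇒rk≡∣A∣ P indep ⟨
      rk P (⁅ i ⁆ ∪ L)      ∎

□-congʳ : (P : SetSystem m) (Q Q' : SetSystem k) → (∀ D → SetSystem.Indep Q D ⇔ SetSystem.Indep Q' D) →
          ∀ V → SetSystem.Indep (P □ Q) V ⇔ SetSystem.Indep (P □ Q') V
□-congʳ {m} P Q Q' Q⇔Q' V = mk⇔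
  (λ (indep , bound) → indep , subst (_≤ corank P (take m V)) (nullity-cong Q Q' Q⇔Q') bound)
  (λ (indep , bound) → indep , subst (_≤ corank P (take m V)) (nullity-cong Q' Q (⇔-sym ∘ Q⇔Q')) bound)
  where
  nullity-cong : (Q Q' : SetSystem _) → (∀ D → SetSystem.Indep Q D ⇔ SetSystem.Indep Q' D) →
                 nullity Q (drop m V) ≡ nullity Q' (drop m V)
  nullity-cong Q Q' Q⇔Q' = cong (∣ drop m V ∣ ∸_) (rk-cong Q Q' Q⇔Q' (drop m V))

□-identityˡ : (N : Matroid 0) (P : SetSystem k) → SetSystem.Indep P ⊥ →
              ∀ V → SetSystem.Indep (Matroid.sys N □ P) V ⇔ SetSystem.Indep P V
□-identityˡ N P indep-⊥ V = mk⇔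
  (λ (_ , bound) → nullity≡0⇒indep P indep-⊥ (n≤0⇒n≡0 (subst (nullity P V ≤_) (n∸n≡0 (rank N.sys)) bound)))
  (λ indep → N.indep-∅ , subst (_≤ corank N.sys []) (sym (indep⇒nullity≡0 P indep)) z≤n)
  where module N = Matroid N

nullity-Fin0 : (P : SetSystem 0) (A : Subset 0) → nullity P A ≡ 0
nullity-Fin0 P [] = 0∸n≡0 (rk P [])

□-identityʳ : (S : SetSystem m) (P : SetSystem 0) →
              ∀ V → SetSystem.Indep (S □ P) V ⇔ SetSystem.Indep S (take m V)
□-identityʳ {m} S P V =
  mk⇔ proj₁ (λ indep → indep , subst (_≤ corank S (take m V)) (sym (nullity-Fin0 P (drop m V))) z≤n)

take-⊥ : ∀ m → take m (⊥ {m + k}) ≡ ⊥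
take-⊥ zero    = refl
take-⊥ (suc m) = cong (false ∷_) (take-⊥ m)

drop-⊥ : ∀ m → drop m (⊥ {m + k}) ≡ ⊥
drop-⊥ zero    = refl
drop-⊥ (suc m) = drop-⊥ m

prodList-indep-⊥ : ∀ fs → SetSystem.Indep (proj₂ (prodList fs)) ⊥
prodList-indep-⊥ []             = _
prodList-indep-⊥ ((k , N) ∷ fs) =
  subst (Matroid.Indep N) (sym (take-⊥ k)) (Matroid.indep-∅ N) ,
  subst (_≤ corank (Matroid.sys N) (take k (⊥ {k + b}))) (sym nullity≡0) z≤n
  where
  b : ℕ
  b = proj₁ (prodList fs)
  P : SetSystem b
  P = proj₂ (prodList fs)
  nullity≡0 : nullity P (drop k (⊥ {k + b})) ≡ 0
  nullity≡0 = subst (λ A → nullity P A ≡ 0) (sym (drop-⊥ k)) (indep⇒nullity≡0 P (prodList-indep-⊥ fs))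

module _ {S : SetSystem m} {T : SetSystem n} where
  open SetSystem

  ≅⇒Indep⇔ : ((f , _) : S ≅ T) → ∀ A → Indep S A ⇔ Indep T (pullback (Inverse.from f) A)
  ≅⇒Indep⇔ (f , T⇔S) A = subst (λ A' → Indep S A' ⇔ Indep T (pullback (Inverse.from f) A))
                               (pullback-to-from f A) (⇔-sym (T⇔S (pullback (Inverse.from f) A)))

  Indep⇔⇒≅ : (f : Fin m ↔ Fin n) → (∀ A → Indep S A ⇔ Indep T (pullback (Inverse.from f) A)) → S ≅ T
  Indep⇔⇒≅ f S⇔T = f , λ B → subst (λ B' → Indep T B' ⇔ Indep S (pullback (Inverse.to f) B))
                                 (pullback-to-from (↔-sym f) B) (⇔-sym (S⇔T (pullback (Inverse.to f) B)))

  ≅-respʳ : {T' : SetSystem n} → S ≅ T → (∀ B → Indep T B ⇔ Indep T' B) → S ≅ T'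
  ≅-respʳ (f , T⇔S) T⇔T' = f , λ B → ⇔-trans (⇔-sym (T⇔T' B)) (T⇔S B)

≅-sym : {S : SetSystem m} {T : SetSystem n} → S ≅ T → T ≅ S
≅-sym {S = S} {T} (f , T⇔S) = Indep⇔⇒≅ {S = T} {T = S} (↔-sym f) T⇔S

≅-trans : {S : SetSystem m} {T : SetSystem n} {U : SetSystem k} → S ≅ T → T ≅ U → S ≅ U
≅-trans {S = S} {U = U} (f , T⇔S) (g , U⇔T) = g ↔-∘ f , λ B →
  subst (λ B' → SetSystem.Indep U B ⇔ SetSystem.Indep S B') (pullback-∘ B)
        (⇔-trans (U⇔T B) (T⇔S (pullback (Inverse.to g) B)))
  where
  pullback-∘ : ∀ B → pullback (Inverse.to f) (pullback (Inverse.to g) B) ≡ pullback (Inverse.to (g ↔-∘ f)) B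
  pullback-∘ B = tabulate-cong λ i → lookup∘tabulate _ (Inverse.to f i)

≅-□-identityʳ : (S : SetSystem m) (P : SetSystem 0) → S ≅ (S □ P)
≅-□-identityʳ {m} S P = ↑ˡ0-↔ , λ V → subst (λ A → SetSystem.Indep (S □ P) V ⇔ SetSystem.Indep S A)
                                        (take≡pullback-↑ˡ V) (□-identityʳ S P V)

-- Bases, circuits and closure

module MatroidTheory {n : ℕ} (M : Matroid n) where
  open Matroid M

  r : Subset n → ℕ
  r = rk sys

  Basis : Subset n → Subset n → Set
  Basis B Y = B ⊆ Y × Indep B × ∣ B ∣ ≡ r Y

  basis-exists : ∀ Y → ∃[ B ] Basis B Y
  basis-exists = rk-attained sys indep-∅

  basis-maximal : ∀ {B Y x} → Basis B Y → x ∈ Y → x ∉ B → ¬ Indep (⁅ x ⁆ ∪ B)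
  basis-maximal {B} {Y} {x} (B⊆Y , _ , ∣B∣≡rY) x∈Y x∉B indep = 1+n≰n (begin
    suc ∣ B ∣      ≡⟨ ∣⁅x⁆∪p∣≡1+∣p∣ x B x∉B ⟨
    ∣ ⁅ x ⁆ ∪ B ∣  ≤⟨ rk-ub sys indep (⁅x⁆∪p⊆q x∈Y B⊆Y) ⟩
    r Y            ≡⟨ ∣B∣≡rY ⟨
    ∣ B ∣          ∎)
    where open ≤-Reasoning

  maximal⇒basis : ∀ {B Y} → Indep B → B ⊆ Y → (∀ {x} → x ∈ Y → x ∉ B → ¬ Indep (⁅ x ⁆ ∪ B)) → Basis B Y
  maximal⇒basis {B} {Y} indep B⊆Y maximal with basis-exists Y
  ... | B' , B'⊆Y , indep' , ∣B'∣≡rY with ∣ B ∣ <? ∣ B' ∣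
  ... | yes ∣B∣<∣B'∣ = let x , x∈B' , x∉B , indep'' = indep-aug indep indep' ∣B∣<∣B'∣
                       in ⊥-elim (maximal (B'⊆Y x∈B') x∉B indep'')
  ... | no  ∣B∣≮∣B'∣ = B⊆Y , indep , ≤-antisym (rk-ub sys indep B⊆Y) (subst (_≤ ∣ B ∣) ∣B'∣≡rY (≮⇒≥ ∣B∣≮∣B'∣))

  basis-extend : ∀ {I Y} → Indep I → I ⊆ Y → ∃[ B ] (I ⊆ B × Basis B Y)
  basis-extend {I} {Y} indep I⊆Y = grow (r Y ∸ ∣ I ∣) I indep I⊆Y ⊆-refl (m+[n∸m]≡n (rk-ub sys indep I⊆Y))
    where
    grow : ∀ d J → Indep J → J ⊆ Y → I ⊆ J → ∣ J ∣ + d ≡ r Y → ∃[ B ] (I ⊆ B × Basis B Y)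
    grow zero    J indep J⊆Y I⊆J ∣J∣≡rY = J , I⊆J , J⊆Y , indep , trans (sym (+-identityʳ ∣ J ∣)) ∣J∣≡rY
    grow (suc d) J indep J⊆Y I⊆J ∣J∣+d≡rY with basis-exists Y
    ... | B₀ , B₀⊆Y , indep₀ , ∣B₀∣≡rY with indep-aug indep indep₀ ∣J∣<∣B₀∣
      where
      ∣J∣<∣B₀∣ : ∣ J ∣ < ∣ B₀ ∣
      ∣J∣<∣B₀∣ = subst (∣ J ∣ <_) (trans ∣J∣+d≡rY (sym ∣B₀∣≡rY)) (m<m+n ∣ J ∣ (s≤s z≤n))
    ... | x , x∈B₀ , x∉J , indep' =
      grow d (⁅ x ⁆ ∪ J) indep' (⁅x⁆∪p⊆q (B₀⊆Y x∈B₀) J⊆Y) (⊆-trans I⊆J p⊆⁅x⁆∪p)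
           (trans (cong (_+ d) (∣⁅x⁆∪p∣≡1+∣p∣ x J x∉J)) (trans (sym (+-suc ∣ J ∣ d)) ∣J∣+d≡rY))

  dependent⇒rk< : ∀ {A} → ¬ Indep A → r A < ∣ A ∣
  dependent⇒rk< {A} dep = ≰⇒> λ ∣A∣≤rA →
    let B , B⊆A , indep , ∣B∣≡rA = basis-exists A
    in dep (indep-down indep (p⊆q⇒∣q∣≤∣p∣⇒q⊆p B⊆A (subst (∣ A ∣ ≤_) (sym ∣B∣≡rA) ∣A∣≤rA)))

  dependent⇒circuit : ∀ {D} → ¬ Indep D → ∃[ C ] (Circuit M C × C ⊆ D)
  dependent⇒circuit {D} dep = shrink ∣ D ∣ D ≤-refl dep ⊆-refl
    where
    shrink : ∀ s E → ∣ E ∣ ≤ s → ¬ Indep E → E ⊆ D → ∃[ C ] (Circuit M C × C ⊆ D)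
    shrink s E ∣E∣≤s dep E⊆D with any? (λ x → x ∈? E ×-dec ¬? (indep? (E - x)))
    shrink zero E ∣E∣≤0 _ _ | yes (x , x∈E , _) = ⊥-elim (<⇒≱ (x∈p⇒0<∣p∣ x∈E) ∣E∣≤0)
    shrink (suc s) E ∣E∣≤1+s _ E⊆D | yes (x , x∈E , dep') =
      shrink s (E - x) (≤-pred (≤-trans (x∈p⇒∣p-x∣<∣p∣ x∈E) ∣E∣≤1+s)) dep' (⊆-trans (p─q⊆p E ⁅ x ⁆) E⊆D)
    shrink s E _ dep E⊆D | no none = E , (dep , proper⇒indep) , E⊆D
      where
      proper⇒indep : ∀ D' → D' ⊂ E → Indep D'
      proper⇒indep D' (D'⊆E , x , x∈E , x∉D') =
        indep-down (decidable-stable (indep? (E - x)) (λ dep → none (x , x∈E , dep)))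
                   (λ y∈D' → x∈p∧x≢y⇒x∈p-y (D'⊆E y∈D') λ { refl → x∉D' y∈D' })

  circuit-avoiding-basis : ∀ {C Z t} → Circuit M C → t ∈ C → C ⊆ Z → ∃[ B ] (Basis B Z × t ∉ B)
  circuit-avoiding-basis {C} {Z} {t} (dep , proper⇒indep) t∈C C⊆Z
    with basis-extend (proper⇒indep (C - t) (x∈p⇒p-x⊂p t∈C)) (⊆-trans (p─q⊆p C ⁅ t ⁆) C⊆Z)
  ... | B , C-t⊆B , basis with t ∈? B
  ... | no  t∉B = B , basis , t∉B
  ... | yes t∈B = ⊥-elim (dep (indep-down (proj₁ (proj₂ basis)) C⊆B))
    where
    C⊆B : C ⊆ B
    C⊆B {y} y∈C with y Data.Fin.≟ t
    ... | yes refl = t∈B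
    ... | no  y≢t  = C-t⊆B (x∈p∧x≢y⇒x∈p-y y∈C y≢t)

  flat-extends-basis : ∀ {Z B s} → Flat M Z → s ∉ Z → Basis B Z → Indep (⁅ s ⁆ ∪ B)
  flat-extends-basis {Z} {B} {s} flat s∉Z basis@(B⊆Z , indep , ∣B∣≡rZ) =
    decidable-stable (indep? (⁅ s ⁆ ∪ B)) λ dep → s∉Z (flat s (trans (sym (basis' dep)) ∣B∣≡rZ))
    where
    basis' : ¬ Indep (⁅ s ⁆ ∪ B) → ∣ B ∣ ≡ r (⁅ s ⁆ ∪ Z)
    basis' dep = proj₂ (proj₂ (maximal⇒basis indep (⊆-trans B⊆Z p⊆⁅x⁆∪p) maximal))
      where
      maximal : ∀ {x} → x ∈ ⁅ s ⁆ ∪ Z → x ∉ B → ¬ Indep (⁅ x ⁆ ∪ B)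
      maximal x∈ x∉B with ∈⁅x⁆∪p⁻ x∈
      ... | inj₁ refl = dep
      ... | inj₂ x∈Z  = basis-maximal basis x∈Z x∉B

  rk-∪-spanned : ∀ {A Y B} → B ⊆ A → Basis B Y → r (A ∪ Y) ≡ r A
  rk-∪-spanned {A} {Y} {B} B⊆A basisY@(_ , indepB , _) with basis-extend indepB B⊆A
  ... | B' , B⊆B' , basisA@(B'⊆A , indep' , ∣B'∣≡rA) =
    trans (sym (proj₂ (proj₂ (maximal⇒basis indep' (⊆-trans B'⊆A (p⊆p∪q Y)) maximal)))) ∣B'∣≡rA
    where
    maximal : ∀ {x} → x ∈ A ∪ Y → x ∉ B' → ¬ Indep (⁅ x ⁆ ∪ B')
    maximal {x} x∈ x∉B' with x∈p∪q⁻ A Y x∈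
    ... | inj₁ x∈A = basis-maximal basisA x∈A x∉B'
    ... | inj₂ x∈Y = basis-maximal basisY x∈Y (x∉B' ∘ B⊆B') ∘ flip indep-down (∪-monoʳ B⊆B')

  cl : Subset n → Subset n
  cl C = tabulate λ x → does (r (⁅ x ⁆ ∪ C) ≟ r C)

  ∈-cl : ∀ {C x} → x ∈ cl C ⇔ r (⁅ x ⁆ ∪ C) ≡ r C
  ∈-cl {C} = ∈-tabulate-does (λ x → r (⁅ x ⁆ ∪ C) ≟ r C)

  ⊆-cl : ∀ {C} → C ⊆ cl C
  ⊆-cl x∈C = Equivalence.from ∈-cl (≤-antisym (rk-mono sys (⁅x⁆∪p⊆q x∈C ⊆-refl)) (rk-mono sys p⊆⁅x⁆∪p))

  basis-cl : ∀ {B C} → Basis B C → Basis B (cl C)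
  basis-cl {B} {C} basis@(B⊆C , indep , ∣B∣≡rC) = maximal⇒basis indep (⊆-trans B⊆C ⊆-cl) maximal
    where
    maximal : ∀ {x} → x ∈ cl C → x ∉ B → ¬ Indep (⁅ x ⁆ ∪ B)
    maximal {x} x∈cl x∉B indep' = 1+n≰n (begin
      suc ∣ B ∣          ≡⟨ ∣⁅x⁆∪p∣≡1+∣p∣ x B x∉B ⟨
      ∣ ⁅ x ⁆ ∪ B ∣      ≤⟨ rk-ub sys indep' (∪-monoʳ B⊆C) ⟩
      r (⁅ x ⁆ ∪ C)      ≡⟨ Equivalence.to ∈-cl x∈cl ⟩
      r C                ≡⟨ ∣B∣≡rC ⟨
      ∣ B ∣              ∎)
      where open ≤-Reasoning

  rk-cl : ∀ C → r (cl C) ≡ r C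
  rk-cl C = let B , basis = basis-exists C
            in trans (sym (proj₂ (proj₂ (basis-cl basis)))) (proj₂ (proj₂ basis))

  cl-flat : ∀ C → Flat M (cl C)
  cl-flat C y rk≡ = Equivalence.from ∈-cl (≤-antisym
    (≤-trans (rk-mono sys (∪-monoʳ ⊆-cl)) (≤-reflexive (trans rk≡ (rk-cl C))))
    (rk-mono sys p⊆⁅x⁆∪p))

  cl-circuit-cyclic : ∀ {C} → Circuit M C → CyclicFlat M (cl C)
  cl-circuit-cyclic {C} circuit = cl-flat C , covered
    where
    covered : UnionOfCircuits M (cl C)
    covered x x∈cl with x ∈? C
    ... | yes x∈C = C , circuit , x∈C , ⊆-cl
    ... | no  x∉C with basis-exists C
    ...   | B , basis@(B⊆C , indep , _)
      with dependent⇒circuit (basis-maximal (basis-cl basis) x∈cl (x∉C ∘ B⊆C))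
    ...     | C' , circuit' , C'⊆ with x ∈? C'
    ...       | yes x∈C' = C' , circuit' , x∈C' , ⊆-trans C'⊆ (⁅x⁆∪p⊆q x∈cl (⊆-trans B⊆C ⊆-cl))
    ...       | no  x∉C' = ⊥-elim (proj₁ circuit' (indep-down indep C'⊆B))
      where
      C'⊆B : C' ⊆ B
      C'⊆B y∈C' with ∈⁅x⁆∪p⁻ (C'⊆ y∈C')
      ... | inj₁ refl = ⊥-elim (x∉C' y∈C')
      ... | inj₂ y∈B  = y∈B

  cyclicFlats-trivial⇒uniform : (∀ Z → CyclicFlat M Z → Z ≡ ⊥ ⊎ Z ≡ ⊤) → Uniform M
  cyclicFlats-trivial⇒uniform trivial = r ⊤ , λ A → mk⇔ (λ indep → rk-ub sys indep ⊆⊤) (small⇒indep A)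
    where
    rank<∣circuit∣ : ∀ {C} → Circuit M C → r ⊤ < ∣ C ∣
    rank<∣circuit∣ {C} circuit@(dep , _) with nonempty? C
    ... | no  empty = ⊥-elim (dep (subst Indep (sym (Empty-unique empty)) indep-∅))
    ... | yes (x , x∈C) with trivial (cl C) (cl-circuit-cyclic circuit)
    ...   | inj₁ cl≡⊥ = ⊥-elim (∉⊥ (subst (x ∈_) cl≡⊥ (⊆-cl x∈C)))
    ...   | inj₂ cl≡⊤ = begin-strict
      r ⊤        ≡⟨ cong r cl≡⊤ ⟨
      r (cl C)   ≡⟨ rk-cl C ⟩
      r C        <⟨ dependent⇒rk< dep ⟩
      ∣ C ∣      ∎
      where open ≤-Reasoning

    small⇒indep : ∀ A → ∣ A ∣ ≤ r ⊤ → Indep A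
    small⇒indep A ∣A∣≤r⊤ = decidable-stable (indep? A) λ dep →
      let C , circuit , C⊆A = dependent⇒circuit dep
      in <⇒≱ (rank<∣circuit∣ circuit) (≤-trans (p⊆q⇒∣p∣≤∣q∣ C⊆A) ∣A∣≤r⊤)

-- image D = I ∪ point[D] with I = image ⊥; the pulled-back matroid is (M / I) restricted to the
-- range of point, with ground set Fin k.
record SubsetEmbedding (k n : ℕ) : Set where
  field
    image      : Subset k → Subset n
    point      : Fin k → Fin n
    image-mono : ∀ {D D'} → D ⊆ D' → image D ⊆ image D'
    ∣image∣    : ∀ D → ∣ image D ∣ ≡ ∣ image ⊥ ∣ + ∣ D ∣
    image-⁅⁆∪  : ∀ j D → image (⁅ j ⁆ ∪ D) ⊆ ⁅ point j ⁆ ∪ image D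
    image-new  : ∀ {x A B} → x ∈ image B → x ∉ image A → ∃[ j ] (x ≡ point j × j ∈ B × j ∉ A)
    image-onto : ∀ {I D} → image ⊥ ⊆ I → I ⊆ image D → ∃[ D' ] (D' ⊆ D × I ≡ image D')

module _ (e : SubsetEmbedding k n) (M : Matroid n) where
  open SubsetEmbedding e
  open Matroid M

  comap : Indep (image ⊥) → Matroid k
  comap indep-image-⊥ = record
    { sys        = record { Indep = Indep ∘ image ; indep? = indep? ∘ image }
    ; indep-∅    = indep-image-⊥
    ; indep-down = λ indep D'⊆D → indep-down indep (image-mono D'⊆D)
    ; indep-aug  = augment
    }
    where
    augment : ∀ {A B} → Indep (image A) → Indep (image B) → ∣ A ∣ < ∣ B ∣ →
              ∃ λ j → j ∈ B × j ∉ A × Indep (image (⁅ j ⁆ ∪ A))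
    augment {A} {B} indepA indepB ∣A∣<∣B∣
      with indep-aug indepA indepB (subst₂ _<_ (sym (∣image∣ A)) (sym (∣image∣ B)) (+-monoʳ-< _ ∣A∣<∣B∣))
    ... | x , x∈B , x∉A , indep' with image-new x∈B x∉A
    ...   | j , refl , j∈B , j∉A = j , j∈B , j∉A , indep-down indep' (image-⁅⁆∪ j A)

  rk-comap : (indep-image-⊥ : Indep (image ⊥)) →
             ∀ D → rk (Matroid.sys (comap indep-image-⊥)) D + ∣ image ⊥ ∣ ≡ rk sys (image D)
  rk-comap indep-image-⊥ D = ≤-antisym lower upper
    where
    open MatroidTheory M using (basis-extend)
    N : Matroid k
    N = comap indep-image-⊥
    lower : rk (Matroid.sys N) D + ∣ image ⊥ ∣ ≤ rk sys (image D)
    lower with rk-attained (Matroid.sys N) indep-image-⊥ D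
    ... | D' , D'⊆D , indep , ∣D'∣≡rk = begin
      rk (Matroid.sys N) D + ∣ image ⊥ ∣  ≡⟨ cong (_+ ∣ image ⊥ ∣) ∣D'∣≡rk ⟨
      ∣ D' ∣ + ∣ image ⊥ ∣                 ≡⟨ trans (∣image∣ D') (+-comm _ ∣ D' ∣) ⟨
      ∣ image D' ∣                         ≤⟨ rk-ub sys indep (image-mono D'⊆D) ⟩
      rk sys (image D)                     ∎
      where open ≤-Reasoning
    upper : rk sys (image D) ≤ rk (Matroid.sys N) D + ∣ image ⊥ ∣
    upper with basis-extend indep-image-⊥ (image-mono ⊥⊆)
    ... | B , image-⊥⊆B , B⊆image , indepB , ∣B∣≡rk with image-onto image-⊥⊆B B⊆image
    ...   | D' , D'⊆D , refl = begin
      rk sys (image D)                     ≡⟨ ∣B∣≡rk ⟨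
      ∣ image D' ∣                         ≡⟨ trans (∣image∣ D') (+-comm _ ∣ D' ∣) ⟩
      ∣ D' ∣ + ∣ image ⊥ ∣                 ≤⟨ +-monoˡ-≤ _ (rk-ub (Matroid.sys N) indepB D'⊆D) ⟩
      rk (Matroid.sys N) D + ∣ image ⊥ ∣  ∎
      where open ≤-Reasoning

relabelling : Fin m ↔ Fin n → SubsetEmbedding m n
relabelling {m} π = record
  { image      = pullback from
  ; point      = to
  ; image-mono = pullback-mono from
  ; ∣image∣    = λ D → trans (∣pullback-from∣ π D)
                            (cong (_+ ∣ D ∣) (sym (trans (∣pullback-from∣ π ⊥) (∣⊥∣≡0 m))))
  ; image-⁅⁆∪  = λ j D → ⊆-reflexive (pullback-from-⁅⁆∪ π j D)
  ; image-new  = λ {x} x∈B x∉A →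
                   from x , sym (strictlyInverseˡ x) , ∈-pullback⁻ from x∈B , x∉A ∘ ∈-pullback⁺ from
  ; image-onto = λ {I} _ I⊆ → pullback to I ,
                   (λ j∈ → subst (_∈ _) (strictlyInverseʳ _) (∈-pullback⁻ from (I⊆ (∈-pullback⁻ to j∈)))) ,
                   sym (pullback-to-from (↔-sym π) I)
  }
  where open Inverse π

relabel : Fin m ↔ Fin n → Matroid n → Matroid m
relabel π N = comap (relabelling π) N
  (Matroid.indep-down N (Matroid.indep-∅ N) (⊥-elim ∘ ∉⊥ ∘ ∈-pullback⁻ (Inverse.from π) {B = ⊥}))

relabel-□-identityʳ : (N : Matroid (m + 0)) (P : SetSystem 0) →
                 ∀ W → SetSystem.Indep (Matroid.sys (relabel ↑ˡ0-↔ N) □ P) W ⇔ Matroid.Indep N W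
relabel-□-identityʳ {m} N P W =
  subst (λ A → SetSystem.Indep (Matroid.sys (relabel ↑ˡ0-↔ N) □ P) W ⇔ Matroid.Indep N A)
        (trans (cong (pullback (cast (+-identityʳ m))) (take≡pullback-↑ˡ W))
               (pullback-to-from (↔-sym ↑ˡ0-↔) W))
        (□-identityʳ _ P W)

-- The lattice 𝒟(M) and its pinchpoints

module _ (M : Matroid n) where

  ⊥∈𝒟 : InD M ⊥
  ⊥∈𝒟 = join (λ _ → Data.Empty.⊥) (λ _ ()) ⊥ λ x → mk⇔ (⊥-elim ∘ ∉⊥) λ ()

  ⊤∈𝒟 : InD M ⊤
  ⊤∈𝒟 = meet (λ _ → Data.Empty.⊥) (λ _ ()) ⊤ λ x → mk⇔ (λ _ _ ()) (λ _ → ∈⊤)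

  𝒟-sandwich : ∀ {A B} → (∀ Z → CyclicFlat M Z → Z ⊆ A ⊎ B ⊆ Z) → ∀ Y → InD M Y → Y ⊆ A ⊎ B ⊆ Y
  𝒟-sandwich cyclic Y (cyc {F} cyclicF) = cyclic F cyclicF
  𝒟-sandwich {A} {B} cyclic Y (join P P⊆𝒟 .Y Y≡⋃P) with ⊆-or-witness Y A
  ... | inj₁ Y⊆A = inj₁ Y⊆A
  ... | inj₂ (y , y∈Y , y∉A) with Equivalence.to (Y≡⋃P y) y∈Y
  ...   | Z , PZ , y∈Z with 𝒟-sandwich cyclic Z (P⊆𝒟 Z PZ)
  ...     | inj₁ Z⊆A = ⊥-elim (y∉A (Z⊆A y∈Z))
  ...     | inj₂ B⊆Z = inj₂ λ {x} x∈B → Equivalence.from (Y≡⋃P x) (Z , PZ , B⊆Z x∈B)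
  𝒟-sandwich {A} {B} cyclic Y (meet P P⊆𝒟 .Y Y≡⋂P) with ⊆-or-witness B Y
  ... | inj₁ B⊆Y = inj₂ B⊆Y
  ... | inj₂ (x , x∈B , x∉Y) = inj₁ λ {y} y∈Y → decidable-stable (y ∈? A) λ y∉A →
    x∉Y (Equivalence.from (Y≡⋂P x) λ Z PZ →
      [ (λ Z⊆A → ⊥-elim (y∉A (Z⊆A (Equivalence.to (Y≡⋂P y) y∈Y Z PZ)))) , (λ B⊆Z → B⊆Z x∈B) ]′
      (𝒟-sandwich cyclic Z (P⊆𝒟 Z PZ)))

  proper-pinchpoint⇒nontrivial : ∀ {X x y} → Pinchpoint M X → x ∈ X → y ∉ X → NontrivialPinchpoint M X
  proper-pinchpoint⇒nontrivial pinch x∈X y∉X =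
    pinch ,
    (λ (_ , minimal) → ∉⊥ (subst (_ ∈_) (sym (minimal ⊥ ⊥∈𝒟 ⊥⊆)) x∈X)) ,
    (λ (_ , maximal) → y∉X (subst (_ ∈_) (maximal ⊤ ⊤∈𝒟 ⊆⊤) ∈⊤))

  nontrivial-pinchpoint⇒proper : ∀ {X} → NontrivialPinchpoint M X → ∃ (_∈ X) × ∃ (_∉ X)
  nontrivial-pinchpoint⇒proper {X} ((X∈𝒟 , _) , not-minimal , not-maximal) = element , non-element
    where
    element : ∃ (_∈ X)
    element = decidable-stable (nonempty? X) λ empty →
      not-minimal (X∈𝒟 , λ Y _ Y⊆X → ⊆-antisym Y⊆X λ x∈X → ⊥-elim (empty (_ , x∈X)))
    non-element : ∃ (_∉ X)
    non-element with ⊆-or-witness ⊤ X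
    ... | inj₁ ⊤⊆X            = ⊥-elim (not-maximal (X∈𝒟 , λ Y _ X⊆Y → ⊆-antisym (λ _ → ⊤⊆X ∈⊤) X⊆Y))
    ... | inj₂ (y , _ , y∉X)  = y , y∉X

  Comparable : Subset n → Set
  Comparable X = ∀ Z → CyclicFlat M Z → Z ⊆ X ⊎ X ⊆ Z

  module _ {X : Subset n} (comparable : Comparable X) where
    private
      Below Above : Fin n → Set
      Below x = ∃[ Z ] ((CyclicFlat M Z × Z ⊆ X) × x ∈ Z)
      Above x = ∀ Z → CyclicFlat M Z × X ⊆ Z → x ∈ Z

      module Decided (below? : ∀ x → Dec (Below x)) (above? : ∀ x → Dec (Above x)) where

        L U : Subset n
        L = tabulate (does ∘ below?)
        U = tabulate (does ∘ above?)

        L⊆X : L ⊆ X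
        L⊆X x∈L = let _ , (_ , Z⊆X) , x∈Z = Equivalence.to (∈-tabulate-does below?) x∈L in Z⊆X x∈Z

        X⊆U : X ⊆ U
        X⊆U x∈X = Equivalence.from (∈-tabulate-does above?) λ Z (_ , X⊆Z) → X⊆Z x∈X

        L-pinchpoint : Pinchpoint M L
        L-pinchpoint =
          join _ (λ _ → cyc ∘ proj₁) L (λ _ → ∈-tabulate-does below?) ,
          λ Y Y∈𝒟 → Sum.map₂ (⊆-trans L⊆X) (𝒟-sandwich cyclic Y Y∈𝒟)
          where
          cyclic : ∀ Z → CyclicFlat M Z → Z ⊆ L ⊎ X ⊆ Z
          cyclic Z cyclicZ = Sum.map₁ below-L (comparable Z cyclicZ)
            where
            below-L : Z ⊆ X → Z ⊆ L
            below-L Z⊆X x∈Z = Equivalence.from (∈-tabulate-does below?) (Z , (cyclicZ , Z⊆X) , x∈Z)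

        U-pinchpoint : Pinchpoint M U
        U-pinchpoint =
          meet _ (λ _ → cyc ∘ proj₁) U (λ _ → ∈-tabulate-does above?) ,
          λ Y Y∈𝒟 → Sum.map₁ (flip ⊆-trans X⊆U) (𝒟-sandwich cyclic Y Y∈𝒟)
          where
          cyclic : ∀ Z → CyclicFlat M Z → Z ⊆ X ⊎ U ⊆ Z
          cyclic Z cyclicZ = Sum.map₂ above-U (comparable Z cyclicZ)
            where
            above-U : X ⊆ Z → U ⊆ Z
            above-U X⊆Z x∈U = Equivalence.to (∈-tabulate-does above?) x∈U Z (cyclicZ , X⊆Z)

        pinchpoint-or-uniform : ∀ {x y} → x ∈ X → y ∉ X → ∃ (NontrivialPinchpoint M) ⊎ Uniform M
        pinchpoint-or-uniform {x} {y} x∈X y∉X with nonempty? L | ⊆-or-witness ⊤ U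
        ... | yes (x' , x'∈L) | _ = inj₁ (L , proper-pinchpoint⇒nontrivial L-pinchpoint x'∈L (y∉X ∘ L⊆X))
        ... | no  _ | inj₂ (y' , _ , y'∉U) =
          inj₁ (U , proper-pinchpoint⇒nontrivial U-pinchpoint (X⊆U x∈X) y'∉U)
        ... | no  L-empty | inj₁ ⊤⊆U = inj₂ (MatroidTheory.cyclicFlats-trivial⇒uniform M trivial)
          where
          trivial : ∀ Z → CyclicFlat M Z → Z ≡ ⊥ ⊎ Z ≡ ⊤
          trivial Z cyclicZ with comparable Z cyclicZ
          ... | inj₁ Z⊆X = inj₁ (Empty-unique λ (z , z∈Z) →
                  L-empty (z , Equivalence.from (∈-tabulate-does below?) (Z , (cyclicZ , Z⊆X) , z∈Z)))
          ... | inj₂ X⊆Z = inj₂ (⊆-antisym ⊆⊤ λ x∈⊤ →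
                  Equivalence.to (∈-tabulate-does above?) (⊤⊆U x∈⊤) Z (cyclicZ , X⊆Z))

    -- Membership in L and U need not be decidable, but the conclusion is stable under double
    -- negation, so a decision procedure may be assumed.
    comparable⇒pinchpoint-or-uniform : ∀ {x y} → x ∈ X → y ∉ X → ¬ ¬ (∃ (NontrivialPinchpoint M) ⊎ Uniform M)
    comparable⇒pinchpoint-or-uniform x∈X y∉X neither =
      ¬¬-decidable Below λ below? → ¬¬-decidable Above λ above? →
      neither (Decided.pinchpoint-or-uniform below? above? x∈X y∉X)

module Split {n m k : ℕ} (f : Fin n ↔ Fin (m + k)) where
  open Inverse f using (to; from; strictlyInverseˡ; strictlyInverseʳ)

  inl : Fin m → Fin n
  inl i = from (i ↑ˡ k)

  inr : Fin k → Fin n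
  inr j = from (m ↑ʳ j)

  left : Subset n → Subset m
  left A = take m (pullback from A)

  right : Subset n → Subset k
  right A = drop m (pullback from A)

  glue : Subset m → Subset k → Subset n
  glue C D = pullback to (C ++ D)

  split-view : ∀ x → (∃[ i ] x ≡ inl i) ⊎ (∃[ j ] x ≡ inr j)
  split-view x with splitAt m (to x) in eq
  ... | inj₁ i = inj₁ (i , trans (sym (strictlyInverseʳ x)) (cong from (sym (splitAt⁻¹-↑ˡ eq))))
  ... | inj₂ j = inj₂ (j , trans (sym (strictlyInverseʳ x)) (cong from (sym (splitAt⁻¹-↑ʳ eq))))

  to-inl : ∀ i → to (inl i) ≡ i ↑ˡ k
  to-inl i = strictlyInverseˡ (i ↑ˡ k)

  to-inr : ∀ j → to (inr j) ≡ m ↑ʳ j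
  to-inr j = strictlyInverseˡ (m ↑ʳ j)

  inl-injective : ∀ {i i'} → inl i ≡ inl i' → i ≡ i'
  inl-injective {i} {i'} eq = ↑ˡ-injective k i i' (trans (sym (to-inl i)) (trans (cong to eq) (to-inl i')))

  inr-injective : ∀ {j j'} → inr j ≡ inr j' → j ≡ j'
  inr-injective {j} {j'} eq = ↑ʳ-injective m j j' (trans (sym (to-inr j)) (trans (cong to eq) (to-inr j')))

  inl≢inr : ∀ {i j} → inl i ≢ inr j
  inl≢inr {i} {j} eq with trans (sym (splitAt-↑ˡ m i k)) (trans (cong (splitAt m) side-eq) (splitAt-↑ʳ m k j))
    where
    side-eq : i ↑ˡ k ≡ m ↑ʳ j
    side-eq = trans (sym (to-inl i)) (trans (cong to eq) (to-inr j))
  ... | ()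

  module _ (A : Subset n) where

    ∈-left⁺ : ∀ {i} → inl i ∈ A → i ∈ left A
    ∈-left⁺ = ∈-take⁺ ∘ ∈-pullback⁺ from

    ∈-left⁻ : ∀ {i} → i ∈ left A → inl i ∈ A
    ∈-left⁻ = ∈-pullback⁻ from ∘ ∈-take⁻

    ∈-right⁺ : ∀ {j} → inr j ∈ A → j ∈ right A
    ∈-right⁺ = ∈-drop⁺ ∘ ∈-pullback⁺ from

    ∈-right⁻ : ∀ {j} → j ∈ right A → inr j ∈ A
    ∈-right⁻ = ∈-pullback⁻ from ∘ ∈-drop⁻

  module _ {C : Subset m} {D : Subset k} where

    ∈-glue-inl⁺ : ∀ {i} → i ∈ C → inl i ∈ glue C D
    ∈-glue-inl⁺ {i} = ∈-pullback⁺ to ∘ subst (_∈ C ++ D) (sym (to-inl i)) ∘ ∈-++ˡ⁺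

    ∈-glue-inl⁻ : ∀ {i} → inl i ∈ glue C D → i ∈ C
    ∈-glue-inl⁻ {i} = ∈-++ˡ⁻ ∘ subst (_∈ C ++ D) (to-inl i) ∘ ∈-pullback⁻ to

    ∈-glue-inr⁺ : ∀ {j} → j ∈ D → inr j ∈ glue C D
    ∈-glue-inr⁺ {j} = ∈-pullback⁺ to ∘ subst (_∈ C ++ D) (sym (to-inr j)) ∘ ∈-++ʳ⁺

    ∈-glue-inr⁻ : ∀ {j} → inr j ∈ glue C D → j ∈ D
    ∈-glue-inr⁻ {j} = ∈-++ʳ⁻ ∘ subst (_∈ C ++ D) (to-inr j) ∘ ∈-pullback⁻ to

  ⊆-by-sides : ∀ {A A'} → (∀ {i} → inl i ∈ A → inl i ∈ A') → (∀ {j} → inr j ∈ A → inr j ∈ A') → A ⊆ A'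
  ⊆-by-sides on-left on-right {x} x∈A with split-view x
  ... | inj₁ (i , refl) = on-left x∈A
  ... | inj₂ (j , refl) = on-right x∈A

  left-glue : ∀ C D → left (glue C D) ≡ C
  left-glue C D =
    ⊆-antisym (∈-glue-inl⁻ {C} {D} ∘ ∈-left⁻ (glue C D)) (∈-left⁺ (glue C D) ∘ ∈-glue-inl⁺ {C} {D})

  right-glue : ∀ C D → right (glue C D) ≡ D
  right-glue C D =
    ⊆-antisym (∈-glue-inr⁻ {C} {D} ∘ ∈-right⁻ (glue C D)) (∈-right⁺ (glue C D) ∘ ∈-glue-inr⁺ {C} {D})

  glue-left-right : ∀ A → glue (left A) (right A) ≡ A
  glue-left-right A = ⊆-antisym
    (⊆-by-sides (∈-left⁻ A ∘ ∈-glue-inl⁻ {left A} {right A}) (∈-right⁻ A ∘ ∈-glue-inr⁻ {left A} {right A}))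
    (⊆-by-sides (∈-glue-inl⁺ {left A} {right A} ∘ ∈-left⁺ A) (∈-glue-inr⁺ {left A} {right A} ∘ ∈-right⁺ A))

  glue-mono : ∀ {C C' D D'} → C ⊆ C' → D ⊆ D' → glue C D ⊆ glue C' D'
  glue-mono {C} {C'} {D} {D'} C⊆C' D⊆D' = ⊆-by-sides
    (∈-glue-inl⁺ {C'} {D'} ∘ C⊆C' ∘ ∈-glue-inl⁻ {C} {D}) (∈-glue-inr⁺ {C'} {D'} ∘ D⊆D' ∘ ∈-glue-inr⁻ {C} {D})

  ∣left∣+∣right∣ : ∀ A → ∣ A ∣ ≡ ∣ left A ∣ + ∣ right A ∣
  ∣left∣+∣right∣ A = begin
    ∣ A ∣                                  ≡⟨ ∣pullback-from∣ f A ⟨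
    ∣ pullback from A ∣                    ≡⟨ cong ∣_∣ (take++drop≡id m (pullback from A)) ⟨
    ∣ left A ++ right A ∣                  ≡⟨ ∣p++q∣≡∣p∣+∣q∣ (left A) (right A) ⟩
    ∣ left A ∣ + ∣ right A ∣               ∎
    where open ≡-Reasoning

  ∣glue∣ : ∀ C D → ∣ glue C D ∣ ≡ ∣ C ∣ + ∣ D ∣
  ∣glue∣ C D =
    trans (∣left∣+∣right∣ (glue C D)) (cong₂ _+_ (cong ∣_∣ (left-glue C D)) (cong ∣_∣ (right-glue C D)))

  left-⁅inl⁆∪ : ∀ i A → left (⁅ inl i ⁆ ∪ A) ≡ ⁅ i ⁆ ∪ left A
  left-⁅inl⁆∪ i A = ⊆-antisym
    (λ i'∈ → case ∈⁅x⁆∪p⁻ (∈-left⁻ (⁅ inl i ⁆ ∪ A) i'∈) of λ where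
      (inj₁ inl≡inl) → subst (_∈ ⁅ i ⁆ ∪ left A) (sym (inl-injective inl≡inl)) x∈⁅x⁆∪p
      (inj₂ inl∈A)   → p⊆⁅x⁆∪p (∈-left⁺ A inl∈A))
    (λ i'∈ → ∈-left⁺ (⁅ inl i ⁆ ∪ A) (case ∈⁅x⁆∪p⁻ i'∈ of λ where
      (inj₁ refl)    → x∈⁅x⁆∪p
      (inj₂ i'∈left) → p⊆⁅x⁆∪p (∈-left⁻ A i'∈left)))

  right-⁅inr⁆∪ : ∀ j A → right (⁅ inr j ⁆ ∪ A) ≡ ⁅ j ⁆ ∪ right A
  right-⁅inr⁆∪ j A = ⊆-antisym
    (λ j'∈ → case ∈⁅x⁆∪p⁻ (∈-right⁻ (⁅ inr j ⁆ ∪ A) j'∈) of λ where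
      (inj₁ inr≡inr) → subst (_∈ ⁅ j ⁆ ∪ right A) (sym (inr-injective inr≡inr)) x∈⁅x⁆∪p
      (inj₂ inr∈A)   → p⊆⁅x⁆∪p (∈-right⁺ A inr∈A))
    (λ j'∈ → ∈-right⁺ (⁅ inr j ⁆ ∪ A) (case ∈⁅x⁆∪p⁻ j'∈ of λ where
      (inj₁ refl)     → x∈⁅x⁆∪p
      (inj₂ j'∈right) → p⊆⁅x⁆∪p (∈-right⁻ A j'∈right)))

  right-⁅inl⁆∪ : ∀ i A → right (⁅ inl i ⁆ ∪ A) ≡ right A
  right-⁅inl⁆∪ i A = ⊆-antisym
    (λ j∈ → case ∈⁅x⁆∪p⁻ (∈-right⁻ (⁅ inl i ⁆ ∪ A) j∈) of λ where
      (inj₁ inr≡inl) → ⊥-elim (inl≢inr (sym inr≡inl))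
      (inj₂ inr∈A)   → ∈-right⁺ A inr∈A)
    (∈-right⁺ (⁅ inl i ⁆ ∪ A) ∘ p⊆⁅x⁆∪p ∘ ∈-right⁻ A)

  left-⁅inr⁆∪ : ∀ j A → left (⁅ inr j ⁆ ∪ A) ≡ left A
  left-⁅inr⁆∪ j A = ⊆-antisym
    (λ i∈ → case ∈⁅x⁆∪p⁻ (∈-left⁻ (⁅ inr j ⁆ ∪ A) i∈) of λ where
      (inj₁ inl≡inr) → ⊥-elim (inl≢inr inl≡inr)
      (inj₂ inl∈A)   → ∈-left⁺ A inl∈A)
    (∈-left⁺ (⁅ inr j ⁆ ∪ A) ∘ p⊆⁅x⁆∪p ∘ ∈-left⁻ A)

  inl∈glue⊤⊥ : ∀ i → inl i ∈ glue ⊤ ⊥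
  inl∈glue⊤⊥ i = ∈-glue-inl⁺ {⊤} {⊥} ∈⊤

  inr∉glue⊤⊥ : ∀ j → inr j ∉ glue ⊤ ⊥
  inr∉glue⊤⊥ j = ∉⊥ ∘ ∈-glue-inr⁻ {⊤} {⊥}

module SplitEmbeddings {n m k : ℕ} (f : Fin n ↔ Fin (m + k)) where
  open Split {n} {m} {k} f

  ∣glue-⊥∣ : ∀ C → ∣ glue C ⊥ ∣ ≡ ∣ C ∣
  ∣glue-⊥∣ C = trans (∣glue∣ C ⊥) (trans (cong (∣ C ∣ +_) (∣⊥∣≡0 k)) (+-identityʳ ∣ C ∣))

  left-embedding : SubsetEmbedding m n
  left-embedding = record
    { image      = λ C → glue C ⊥
    ; point      = inl
    ; image-mono = λ C⊆C' → glue-mono C⊆C' ⊆-refl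
    ; ∣image∣    = λ C → trans (∣glue-⊥∣ C) (cong (_+ ∣ C ∣) (sym (trans (∣glue-⊥∣ ⊥) (∣⊥∣≡0 m))))
    ; image-⁅⁆∪  = λ i C → ⊆-by-sides
        (λ inl∈ → case ∈⁅x⁆∪p⁻ (∈-glue-inl⁻ {⁅ i ⁆ ∪ C} {⊥} inl∈) of λ where
          (inj₁ refl) → x∈⁅x⁆∪p
          (inj₂ i'∈C) → p⊆⁅x⁆∪p (∈-glue-inl⁺ {C} {⊥} i'∈C))
        (⊥-elim ∘ ∉⊥ ∘ ∈-glue-inr⁻ {⁅ i ⁆ ∪ C} {⊥})
    ; image-new  = new
    ; image-onto = onto
    }
    where
    new : ∀ {x A B} → x ∈ glue B ⊥ → x ∉ glue A ⊥ → ∃[ i ] (x ≡ inl i × i ∈ B × i ∉ A)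
    new {x} {A} {B} x∈B x∉A with split-view x
    ... | inj₁ (i , refl) = i , refl , ∈-glue-inl⁻ {B} {⊥} x∈B , x∉A ∘ ∈-glue-inl⁺ {A} {⊥}
    ... | inj₂ (j , refl) = ⊥-elim (∉⊥ (∈-glue-inr⁻ {B} {⊥} x∈B))
    onto : ∀ {I C} → glue ⊥ ⊥ ⊆ I → I ⊆ glue C ⊥ → ∃[ C' ] (C' ⊆ C × I ≡ glue C' ⊥)
    onto {I} {C} _ I⊆ = left I , ∈-glue-inl⁻ {C} {⊥} ∘ I⊆ ∘ ∈-left⁻ I ,
      trans (sym (glue-left-right I)) (cong (glue (left I)) right≡⊥)
      where
      right≡⊥ : right I ≡ ⊥
      right≡⊥ = ⊆-antisym (⊥-elim ∘ ∉⊥ ∘ ∈-glue-inr⁻ {C} {⊥} ∘ I⊆ ∘ ∈-right⁻ I) ⊥⊆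

  right-embedding : Subset m → SubsetEmbedding k n
  right-embedding C₀ = record
    { image      = glue C₀
    ; point      = inr
    ; image-mono = glue-mono {C₀} {C₀} ⊆-refl
    ; ∣image∣    = λ D → trans (∣glue∣ C₀ D) (cong (_+ ∣ D ∣) (sym (∣glue-⊥∣ C₀)))
    ; image-⁅⁆∪  = λ j D → ⊆-by-sides
        (p⊆⁅x⁆∪p ∘ ∈-glue-inl⁺ {C₀} {D} ∘ ∈-glue-inl⁻ {C₀} {⁅ j ⁆ ∪ D})
        (λ inr∈ → case ∈⁅x⁆∪p⁻ (∈-glue-inr⁻ {C₀} {⁅ j ⁆ ∪ D} inr∈) of λ where
          (inj₁ refl) → x∈⁅x⁆∪p
          (inj₂ j'∈D) → p⊆⁅x⁆∪p (∈-glue-inr⁺ {C₀} {D} j'∈D))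
    ; image-new  = new
    ; image-onto = onto
    }
    where
    new : ∀ {x A B} → x ∈ glue C₀ B → x ∉ glue C₀ A → ∃[ j ] (x ≡ inr j × j ∈ B × j ∉ A)
    new {x} {A} {B} x∈B x∉A with split-view x
    ... | inj₁ (i , refl) = ⊥-elim (x∉A (∈-glue-inl⁺ {C₀} {A} (∈-glue-inl⁻ {C₀} {B} x∈B)))
    ... | inj₂ (j , refl) = j , refl , ∈-glue-inr⁻ {C₀} {B} x∈B , x∉A ∘ ∈-glue-inr⁺ {C₀} {A}
    onto : ∀ {I D} → glue C₀ ⊥ ⊆ I → I ⊆ glue C₀ D → ∃[ D' ] (D' ⊆ D × I ≡ glue C₀ D')
    onto {I} {D} ⊆I I⊆ = right I , ∈-glue-inr⁻ {C₀} {D} ∘ I⊆ ∘ ∈-right⁻ I ,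
      trans (sym (glue-left-right I)) (cong (λ C → glue C (right I)) left≡C₀)
      where
      left≡C₀ : left I ≡ C₀
      left≡C₀ = ⊆-antisym (∈-glue-inl⁻ {C₀} {D} ∘ I⊆ ∘ ∈-left⁻ I) (∈-left⁺ I ∘ ⊆I ∘ ∈-glue-inl⁺ {C₀} {⊥})

-- The padding + 0 matches the ground set of a two-factor prodList.
splitting : (X : Subset n) → Fin n ↔ Fin (∣ X ∣ + (∣ ∁ X ∣ + 0))
splitting X = ↔-sym +↔⊎ ↔-∘ ((↔-refl ⊎-↔ ↑ˡ0-↔) ↔-∘ partition X)

glue-splitting : (X : Subset n) → Split.glue {n} {∣ X ∣} {∣ ∁ X ∣ + 0} (splitting X) ⊤ ⊥ ≡ X
glue-splitting {n} X = ⊆-antisym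
  (⊆-by-sides (λ {i} _ → subst (_∈ X) (sym (inl≡ i)) (Partition.from-inj₁∈ X i))
              (λ {j} inr∈ → ⊥-elim (inr∉glue⊤⊥ j inr∈)))
  (⊆-by-sides (λ {i} _ → inl∈glue⊤⊥ i)
              (λ {j} inr∈X → ⊥-elim (Partition.from-inj₂∉ X _ (subst (_∈ X) (inr≡ j) inr∈X))))
  where
  open Split {n} {∣ X ∣} {∣ ∁ X ∣ + 0} (splitting X)
  inl≡ : ∀ i → inl i ≡ Partition.from X (inj₁ i)
  inl≡ i rewrite splitAt-↑ˡ ∣ X ∣ i (∣ ∁ X ∣ + 0) = refl
  inr≡ : ∀ j → inr j ≡ Partition.from X (inj₂ (cast (+-identityʳ _) j))
  inr≡ j rewrite splitAt-↑ʳ ∣ X ∣ (∣ ∁ X ∣ + 0) j = refl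

-- Cyclic flats of a free product

module _ (M : Matroid n) (P : SetSystem m) (Q : SetSystem k) (iso : Matroid.sys M ≅ (P □ Q)) where
  open Matroid M
  open MatroidTheory M
  open Split {n} {m} {k} (proj₁ iso)

  private
    Indep⇔ : ∀ A → Indep A ⇔ (SetSystem.Indep P (left A) × nullity Q (right A) ≤ corank P (left A))
    Indep⇔ = ≅⇒Indep⇔ {S = sys} {T = P □ Q} iso

  swap-inl-for-inr : ∀ {B i j} → Indep B → Indep (⁅ inl i ⁆ ∪ B) → inl i ∉ B → Indep (⁅ inr j ⁆ ∪ B)
  swap-inl-for-inr {B} {i} {j} indepB indep-inl inl∉B = Equivalence.from (Indep⇔ _)
    ( subst (SetSystem.Indep P) (sym (left-⁅inr⁆∪ j B)) (proj₁ (Equivalence.to (Indep⇔ B) indepB))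
    , subst₂ (λ L R → nullity Q R ≤ corank P L) (sym (left-⁅inr⁆∪ j B)) (sym (right-⁅inr⁆∪ j B))
             (□-trade P Q indepP (inl∉B ∘ ∈-left⁻ B) bound))
    where
    with-inl : SetSystem.Indep (P □ Q) (pullback (Inverse.from (proj₁ iso)) (⁅ inl i ⁆ ∪ B))
    with-inl = Equivalence.to (Indep⇔ _) indep-inl
    indepP : SetSystem.Indep P (⁅ i ⁆ ∪ left B)
    indepP = subst (SetSystem.Indep P) (left-⁅inl⁆∪ i B) (proj₁ with-inl)
    bound : nullity Q (right B) ≤ corank P (⁅ i ⁆ ∪ left B)
    bound = subst₂ (λ L R → nullity Q R ≤ corank P L) (left-⁅inl⁆∪ i B) (right-⁅inl⁆∪ i B) (proj₂ with-inl)

  cyclicFlat-∋inr⇒∋inl : ∀ {Z i j} → CyclicFlat M Z → inr j ∈ Z → inl i ∈ Z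
  cyclicFlat-∋inr⇒∋inl {Z} {i} {j} (flat , covered) inr∈Z = decidable-stable (inl i ∈? Z) λ inl∉Z →
    let C , circuit , inr∈C , C⊆Z = covered (inr j) inr∈Z
        B , basis@(B⊆Z , indepB , _) , inr∉B = circuit-avoiding-basis circuit inr∈C C⊆Z
    in basis-maximal basis inr∈Z inr∉B
         (swap-inl-for-inr indepB (flat-extends-basis flat inl∉Z basis) (inl∉Z ∘ B⊆Z))

  free-factor-comparable : Comparable M (glue ⊤ ⊥)
  free-factor-comparable Z cyclic with ⊆-or-witness Z (glue ⊤ ⊥)
  ... | inj₁ Z⊆X = inj₁ Z⊆X
  ... | inj₂ (t , t∈Z , t∉X) with split-view t
  ...   | inj₁ (i , refl) = ⊥-elim (t∉X (inl∈glue⊤⊥ i))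
  ...   | inj₂ (j , refl) = inj₂ (⊆-by-sides
          (λ _ → cyclicFlat-∋inr⇒∋inl cyclic t∈Z)
          (λ {j'} inr∈X → ⊥-elim (inr∉glue⊤⊥ j' inr∈X)))

-- Decomposition as M|X □ M/X

module Decomposition {n m k : ℕ} (M : Matroid n) (f : Fin n ↔ Fin (m + k))
                     (comparable : Comparable M (Split.glue {n} {m} {k} f ⊤ ⊥)) where
  open Matroid M
  open MatroidTheory M
  open Split {n} {m} {k} f
  open SplitEmbeddings {n} {m} {k} f

  private
    X : Subset n
    X = glue ⊤ ⊥

    B-X : Subset n
    B-X = proj₁ (basis-exists X)

    basis-X : Basis B-X X
    basis-X = proj₂ (basis-exists X)

  glue-left-B-X : glue (left B-X) ⊥ ≡ B-X
  glue-left-B-X = trans (cong (glue (left B-X)) right≡⊥) (glue-left-right B-X)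
    where
    right≡⊥ : ⊥ ≡ right B-X
    right≡⊥ = ⊆-antisym ⊥⊆ (λ {j} j∈ → ⊥-elim (inr∉glue⊤⊥ j (proj₁ basis-X (∈-right⁻ B-X j∈))))

  private
    indep-glue-⊥-⊥ : Indep (glue ⊥ ⊥)
    indep-glue-⊥-⊥ = indep-down indep-∅
      (⊆-by-sides (⊥-elim ∘ ∉⊥ ∘ ∈-glue-inl⁻ {⊥} {⊥}) (⊥-elim ∘ ∉⊥ ∘ ∈-glue-inr⁻ {⊥} {⊥}))

    indep-glue-left-B-X : Indep (glue (left B-X) ⊥)
    indep-glue-left-B-X = subst Indep (sym glue-left-B-X) (proj₁ (proj₂ basis-X))

  restriction : Matroid m
  restriction = comap left-embedding M indep-glue-⊥-⊥

  contraction : Matroid k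
  contraction = comap (right-embedding (left B-X)) M indep-glue-left-B-X

  private
    R : SetSystem m
    R = Matroid.sys restriction
    C : SetSystem k
    C = Matroid.sys contraction

  rank-restriction : rank R ≡ r X
  rank-restriction = begin
    rk R ⊤                     ≡⟨ +-identityʳ _ ⟨
    rk R ⊤ + 0                 ≡⟨ cong (rk R ⊤ +_) (trans (∣glue-⊥∣ ⊥) (∣⊥∣≡0 m)) ⟨
    rk R ⊤ + ∣ glue ⊥ ⊥ ∣      ≡⟨ rk-comap left-embedding M indep-glue-⊥-⊥ ⊤ ⟩
    r X                        ∎
    where open ≡-Reasoning

  rk-contraction : ∀ D → rk C D + r X ≡ r (glue ⊤ D)
  rk-contraction D = begin
    rk C D + r X                 ≡⟨ cong (rk C D +_) (trans (sym (proj₂ (proj₂ basis-X)))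
                                                           (cong ∣_∣ (sym glue-left-B-X))) ⟩
    rk C D + ∣ glue (left B-X) ⊥ ∣ ≡⟨ rk-comap (right-embedding (left B-X)) M indep-glue-left-B-X D ⟩
    r (glue (left B-X) D)        ≡⟨ ≤-antisym (rk-mono sys (glue-mono {left B-X} {⊤} {D} {D} ⊆⊤ ⊆-refl))
                                              spanned ⟩
    r (glue ⊤ D)                 ∎
    where
    open ≡-Reasoning
    B-X⊆ : B-X ⊆ glue (left B-X) D
    B-X⊆ = subst (_⊆ glue (left B-X) D) glue-left-B-X (glue-mono {left B-X} {left B-X} ⊆-refl ⊥⊆)
    spanned : r (glue ⊤ D) ≤ r (glue (left B-X) D)
    spanned = ≤-trans (rk-mono sys (⊆-by-sides
                        (λ {i} _ → x∈p∪q⁺ (inj₂ (inl∈glue⊤⊥ i)))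
                        (λ inr∈ → x∈p∪q⁺ (inj₁ (∈-glue-inr⁺ {left B-X} {D} (∈-glue-inr⁻ {⊤} {D} inr∈))))))
                      (≤-reflexive (rk-∪-spanned B-X⊆ basis-X))

  module _ (A : Subset n) where

    glue-left⊆ : glue (left A) ⊥ ⊆ A
    glue-left⊆ = ⊆-by-sides (∈-left⁻ A ∘ ∈-glue-inl⁻ {left A} {⊥}) (⊥-elim ∘ ∉⊥ ∘ ∈-glue-inr⁻ {left A} {⊥})

    ⊆glue-⊤-right : A ⊆ glue ⊤ (right A)
    ⊆glue-⊤-right = ⊆-by-sides (λ _ → ∈-glue-inl⁺ {⊤} {right A} ∈⊤) (∈-glue-inr⁺ {⊤} {right A} ∘ ∈-right⁺ A)

    □-bound⇔ : Indep (glue (left A) ⊥) →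
               ∣ A ∣ ≤ r (glue ⊤ (right A)) ⇔ nullity C (right A) ≤ corank R (left A)
    □-bound⇔ indep-left =
      subst₂ (λ a b → a ≤ b ⇔ nullity C D ≤ corank R L) (sym (∣left∣+∣right∣ A)) (rk-contraction D)
        (subst (λ c → ∣ L ∣ + ∣ D ∣ ≤ rk C D + r X ⇔ nullity C D ≤ c) corank≡ (+≤+⇔∸≤∸ ∣L∣≤rX))
      where
      L : Subset m
      L = left A
      D : Subset k
      D = right A
      rk-L : rk R L ≡ ∣ L ∣
      rk-L = indep⇒rk≡∣A∣ R indep-left
      ∣L∣≤rX : ∣ L ∣ ≤ r X
      ∣L∣≤rX = subst₂ _≤_ rk-L rank-restriction (rk-mono R ⊆⊤)
      corank≡ : r X ∸ ∣ L ∣ ≡ corank R L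
      corank≡ = cong₂ _∸_ (sym rank-restriction) (sym rk-L)

  indep⇒□ : ∀ {A} → Indep A → SetSystem.Indep (R □ C) (pullback (Inverse.from f) A)
  indep⇒□ {A} indepA = indep-left , Equivalence.to (□-bound⇔ A indep-left) (begin
    ∣ A ∣                   ≡⟨ indep⇒rk≡∣A∣ sys indepA ⟨
    r A                     ≤⟨ rk-mono sys (⊆glue-⊤-right A) ⟩
    r (glue ⊤ (right A))    ∎)
    where
    open ≤-Reasoning
    indep-left : Indep (glue (left A) ⊥)
    indep-left = indep-down indepA (glue-left⊆ A)

  □⇒indep : ∀ {A} → SetSystem.Indep (R □ C) (pullback (Inverse.from f) A) → Indep A
  □⇒indep {A} (indep-left , bound) = decidable-stable (indep? A) λ dep →
    let Z , circuit , Z⊆A = dependent⇒circuit dep in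
    case comparable (cl Z) (cl-circuit-cyclic circuit) of λ where
      (inj₁ cl⊆X) → proj₁ circuit (indep-down indep-left (⊆-by-sides
        (∈-glue-inl⁺ {left A} {⊥} ∘ ∈-left⁺ A ∘ Z⊆A)
        (λ {j} inr∈Z → ⊥-elim (inr∉glue⊤⊥ j (cl⊆X (⊆-cl inr∈Z))))))
      (inj₂ X⊆cl) → <⇒≱ (dependent⇒rk< dep) (begin
        ∣ A ∣                   ≤⟨ Equivalence.from (□-bound⇔ A indep-left) bound ⟩
        r (glue ⊤ (right A))    ≤⟨ rk-mono sys (⊆-by-sides
                                     (λ {i} _ → x∈p∪q⁺ (inj₂ (X⊆cl (inl∈glue⊤⊥ i))))
                                     (λ inr∈ → x∈p∪q⁺ (inj₁ (∈-right⁻ A (∈-glue-inr⁻ {⊤} {right A} inr∈))))) ⟩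
        r (A ∪ cl Z)            ≡⟨ cl-spanned Z⊆A ⟩
        r A                     ∎)
    where
    open ≤-Reasoning
    cl-spanned : ∀ {Z} → Z ⊆ A → r (A ∪ cl Z) ≡ r A
    cl-spanned {Z} Z⊆A = let B , basis@(B⊆Z , _) = basis-exists Z
                         in rk-∪-spanned (⊆-trans B⊆Z Z⊆A) (basis-cl basis)

  decomposition : sys ≅ (R □ C)
  decomposition = Indep⇔⇒≅ {S = sys} {T = R □ C} f λ A → mk⇔ indep⇒□ □⇒indep

comparable⇒two-factors : (M : Matroid n) {X : Subset n} → Comparable M X →
  Σ (Matroid ∣ X ∣) λ N₁ → Σ (Matroid ∣ ∁ X ∣) λ N₂ →
    Matroid.sys M ≅ proj₂ (prodList ((_ , N₁) ∷ (_ , N₂) ∷ []))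
comparable⇒two-factors M {X} comparable =
  restriction , N₂ ,
  ≅-respʳ {S = Matroid.sys M} {T = R □ C} {T' = R □ (Matroid.sys N₂ □ emptySys)} decomposition
          (□-congʳ R C (Matroid.sys N₂ □ emptySys) (⇔-sym ∘ relabel-□-identityʳ contraction emptySys))
  where
  open Decomposition {m = ∣ X ∣} {k = ∣ ∁ X ∣ + 0} M (splitting X)
    (subst (Comparable M) (sym (glue-splitting X)) comparable)
  R : SetSystem ∣ X ∣
  R = Matroid.sys restriction
  C : SetSystem (∣ ∁ X ∣ + 0)
  C = Matroid.sys contraction
  N₂ : Matroid ∣ ∁ X ∣
  N₂ = relabel ↑ˡ0-↔ contraction

factor≇product : {S : SetSystem n} {a b : ℕ} (N₁ : Matroid a) (N₂ : Matroid b) → 0 < a → 0 < b →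
                  S ≅ proj₂ (prodList ((a , N₁) ∷ (b , N₂) ∷ [])) →
                  ¬ Any (λ kN → Matroid.sys (proj₂ kN) ≅ S) ((a , N₁) ∷ (b , N₂) ∷ [])
factor≇product {a = a} {b} _ _ 0<a 0<b (f , _) (here (φ , _)) =
  m≢m+n a (subst (0 <_) (sym (+-identityʳ b)) 0<b) (trans (↔⇒≡ φ) (↔⇒≡ f))
factor≇product {a = a} {b} _ _ 0<a 0<b (f , _) (there (here (φ , _))) =
  m≢m+n b 0<a (trans (↔⇒≡ φ) (trans (↔⇒≡ f) (trans (cong (a +_) (+-identityʳ b)) (+-comm a b))))

irreducible⇒no-nontrivial-pinchpoint : (M : Matroid n) → Irreducible M → NoNontrivialPinchpoint M
irreducible⇒no-nontrivial-pinchpoint M (_ , irreducible) (X , nontrivial@((_ , pinch) , _)) =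
  let (x , x∈X) , (y , y∉X) = nontrivial-pinchpoint⇒proper M nontrivial
      N₁ , N₂ , iso = comparable⇒two-factors M (λ Z cyclicZ → pinch Z (cyc cyclicZ))
  in factor≇product {S = Matroid.sys M} N₁ N₂ (x∈p⇒0<∣p∣ x∈X) (x∈p⇒0<∣p∣ (x∉p⇒x∈∁p y∉X)) iso
                    (irreducible _ iso)

record ProperFactorisation (S : SetSystem n) : Set₁ where
  field
    {a b}  : ℕ
    first  : SetSystem (suc a)
    second : SetSystem (suc b)
    iso    : S ≅ (first □ second)

factor-or-proper-factorisation : {S : SetSystem n} → 0 < n → ∀ fs → S ≅ proj₂ (prodList fs) →
  Any (λ kN → Matroid.sys (proj₂ kN) ≅ S) fs ⊎ ProperFactorisation S
factor-or-proper-factorisation 0<n [] iso = ⊥-elim (<⇒≢ 0<n (sym (↔⇒≡ (proj₁ iso))))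
factor-or-proper-factorisation {S = S} 0<n ((zero , N) ∷ fs) iso = Sum.map₁ there
  (factor-or-proper-factorisation 0<n fs
    (≅-respʳ {S = S} {T = Matroid.sys N □ P} {T' = P} iso (□-identityˡ N P (prodList-indep-⊥ fs))))
  where
  P : SetSystem (proj₁ (prodList fs))
  P = proj₂ (prodList fs)
factor-or-proper-factorisation {S = S} 0<n ((suc a , N) ∷ fs) iso = last-or-split (prodList fs) iso
  where
  last-or-split : ((b , P) : Σ ℕ SetSystem) → S ≅ (Matroid.sys N □ P) →
                  Any (λ kN → Matroid.sys (proj₂ kN) ≅ S) ((suc a , N) ∷ fs) ⊎ ProperFactorisation S
  last-or-split (zero  , P) iso = inj₁ (here (≅-trans {S = Matroid.sys N} {T = Matroid.sys N □ P} {U = S}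
    (≅-□-identityʳ (Matroid.sys N) P) (≅-sym {S = S} {T = Matroid.sys N □ P} iso)))
  last-or-split (suc b , P) iso = inj₂ record { first = Matroid.sys N ; second = P ; iso = iso }

nonuniform⇒0<n : (M : Matroid n) → NonUniform M → 0 < n
nonuniform⇒0<n {zero}  M nonuniform =
  ⊥-elim (nonuniform (0 , λ { [] → mk⇔ (λ _ → z≤n) (λ _ → Matroid.indep-∅ M) }))
nonuniform⇒0<n {suc n} M _          = s≤s z≤n

no-nontrivial-pinchpoint⇒irreducible : (M : Matroid n) → NonUniform M → NoNontrivialPinchpoint M → Irreducible M
no-nontrivial-pinchpoint⇒irreducible {n} M nonuniform no-pinchpoint =
  0<n , λ fs iso → [ id , ⊥-elim ∘ no-proper-factorisation ]′ (factor-or-proper-factorisation 0<n fs iso)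
  where
  0<n : 0 < n
  0<n = nonuniform⇒0<n M nonuniform
  no-proper-factorisation : ¬ ProperFactorisation (Matroid.sys M)
  no-proper-factorisation record { a = a ; b = b ; first = P ; second = Q ; iso = iso } =
    comparable⇒pinchpoint-or-uniform M (free-factor-comparable M P Q iso) (inl∈glue⊤⊥ zero) (inr∉glue⊤⊥ zero)
      [ no-pinchpoint , nonuniform ]′
    where open Split {n} {suc a} {suc b} (proj₁ iso)

theorem6p11 : (n : ℕ) (M : Matroid n) → NonUniform M →
    (Irreducible M ⇔ NoNontrivialPinchpoint M)
theorem6p11 n M nonuniform =
  mk⇔ (irreducible⇒no-nontrivial-pinchpoint M) (no-nontrivial-pinchpoint⇒irreducible M nonuniform)
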